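{- If $G$ is a $2$-edge-connected claw-free cubic graph, then $G$ is $(1,1,1,3)$-packing edge-colorable; that is, $E(G)$ can be partitioned into sets $E_1, E_2, E_3, E_4$ such that each of $E_1, E_2, E_3$ is a matching and any two distinct edges of $E_4$ are at edge-distance at least $4$.
   Context: Graphs are finite and simple. A graph is claw-free if it contains no induced subgraph isomorphic to $K_{1,3}$; it is cubic if every vertex has degree $3$; it is $2$-edge-connected if it is connected and has no bridge. The edge-distance between two edges of $G$ is their distance as vertices in the line graph of $G$. For a non-decreasing sequence of positive integers $S=(s_1,\dots,s_k)$, an $S$-packing edge-coloring of $G$ is a partition of $E(G)$ into sets $E_1,\dots,E_k$ such that for each $i$, any two distinct edges of $E_i$ have edge-distance at least $s_i+1$. -}

module Defs where

open import Data.Nat using (ℕ; zero; suc; _≤_; _<_)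
open import Data.Fin using (Fin; toℕ)
open import Data.Bool using (Bool; true; false)
open import Data.Vec using (Vec; lookup; _∷_; [])
open import Data.Product using (Σ; ∃; _×_; _,_; proj₁; proj₂)
open import Data.Sum using (_⊎_)
open import Relation.Nullary using (¬_)
open import Relation.Binary.PropositionalEquality using (_≡_; _≢_)
open import Relation.Binary.Construct.Closure.ReflexiveTransitive using (Star)

record Graph : Set where
  field
    n     : ℕ
    adj   : Fin n → Fin n → Bool
    sym   : ∀ u v → adj u v ≡ adj v u
    irrefl : ∀ u → adj u u ≡ false

open Graph public

Vertex : Graph → Set
Vertex G = Fin (n G)

Adj : (G : Graph) → Vertex G → Vertex G → Set
Adj G u v = adj G u v ≡ true

-- An edge {u,v} is represented canonically as (u , v) with u < v.
Edge : Graph → Set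
Edge G = Σ (Vertex G × Vertex G) λ p → (toℕ (proj₁ p) < toℕ (proj₂ p)) × Adj G (proj₁ p) (proj₂ p)

end₁ : {G : Graph} → Edge G → Vertex G
end₁ e = proj₁ (proj₁ e)

end₂ : {G : Graph} → Edge G → Vertex G
end₂ e = proj₂ (proj₁ e)

_∈ₑ_ : {G : Graph} → Vertex G → Edge G → Set
_∈ₑ_ {G} x e = x ≡ end₁ {G} e ⊎ x ≡ end₂ {G} e

ConnectedBy : (G : Graph) → (Vertex G → Vertex G → Set) → Set
ConnectedBy G R = ∀ (x y : Vertex G) → Star R x y

Connected : Graph → Set
Connected G = ConnectedBy G (Adj G)

AdjMinus : (G : Graph) → Edge G → Vertex G → Vertex G → Set
AdjMinus G e x y =
  Adj G x y × ¬ (x ≡ end₁ {G} e × y ≡ end₂ {G} e) × ¬ (x ≡ end₂ {G} e × y ≡ end₁ {G} e)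

IsBridge : (G : Graph) → Edge G → Set
IsBridge G e = ¬ ConnectedBy G (AdjMinus G e)

TwoEdgeConnected : Graph → Set
TwoEdgeConnected G = Connected G × (∀ (e : Edge G) → ¬ IsBridge G e)

Cubic : Graph → Set
Cubic G = ∀ (v : Vertex G) → Σ (Vertex G) λ a → Σ (Vertex G) λ b → Σ (Vertex G) λ c →
  a ≢ b × a ≢ c × b ≢ c ×
  Adj G v a × Adj G v b × Adj G v c ×
  (∀ w → Adj G v w → w ≡ a ⊎ w ≡ b ⊎ w ≡ c)

ClawFree : Graph → Set
ClawFree G = ¬ (Σ (Vertex G) λ v → Σ (Vertex G) λ a → Σ (Vertex G) λ b → Σ (Vertex G) λ c →
  a ≢ b × a ≢ c × b ≢ c ×
  Adj G v a × Adj G v b × Adj G v c ×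
  ¬ Adj G a b × ¬ Adj G a c × ¬ Adj G b c)

LineAdj : (G : Graph) → Edge G → Edge G → Set
LineAdj G e f = e ≢ f × Σ (Vertex G) λ x → _∈ₑ_ {G} x e × _∈ₑ_ {G} x f

data LWalk (G : Graph) : Edge G → Edge G → ℕ → Set where
  here : ∀ {e} → LWalk G e e zero
  step : ∀ {e f g k} → LineAdj G e f → LWalk G f g k → LWalk G e g (suc k)

EdgeDistAtMost : (G : Graph) → ℕ → Edge G → Edge G → Set
EdgeDistAtMost G d e f = Σ ℕ λ k → k ≤ d × LWalk G e f k

-- S-packing edge-coloring, S = (s_1,…,s_k) given as a vector; the colour
-- classes E_i = c⁻¹(i) partition E(G).
IsPackingEdgeColoring : (G : Graph) {k : ℕ} → Vec ℕ k → (Edge G → Fin k) → Set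
IsPackingEdgeColoring G S c =
  ∀ (e f : Edge G) → e ≢ f → c e ≡ c f →
    ¬ EdgeDistAtMost G (lookup S (c e)) e f

PackingEdgeColorable : (G : Graph) {k : ℕ} → Vec ℕ k → Set
PackingEdgeColorable G {k} S = Σ (Edge G → Fin k) λ c → IsPackingEdgeColoring G S c

-- In a claw-free cubic graph other than K₄ every vertex lies in a diamond (K₄ minus an edge) or in exactly
-- one triangle, and the remaining edges, the links, join these units.  Colour 3F, whose edges must be pairwise
-- at edge-distance at least 4, goes to the middle edge of every diamond and to at most one edge of each free
-- triangle; the free triangles form a maximal independent set among the triangles all of whose links lead to
-- triangles, two triangles conflicting when a link joins them.  Every other triangle then has a link leading to
-- a diamond or a free triangle, so the links between non-free triangles form a graph of maximum degree two and
-- are 3-coloured greedily.  Each non-free triangle completes its link colours to three distinct ones and gives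
-- every edge the colour of the opposite link; diamonds and free triangles are coloured by small tables checked
-- exhaustively.  K₄ itself is 3-edge-colourable.

module Submission where

open import Defs renaming (sym to adj-sym)
open import Axiom.UniquenessOfIdentityProofs using (module Decidable⇒UIP)
open import Data.Bool using (Bool; true; false; not; _∧_; _∨_; _xor_; if_then_else_; T)
open import Data.Bool.ListAction using (or)
open import Data.Bool.Properties using (∧-zeroʳ; ∨-zeroʳ; not-distribˡ-xor; not-distribʳ-xor) renaming (_≟_ to _≟ᵇ_)
open import Data.Empty using (⊥; ⊥-elim)
open import Data.Fin using (Fin; toℕ; inject₁; _<_)
open import Data.Fin.Patterns using (0F; 1F; 2F; 3F)
open import Data.Fin.Properties
  using (_≟_; _<?_; <-cmp; <-asym; <-trans; <-irrefl; all?; any?; fromℕ≢inject₁; inject₁-injective)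
open import Data.List using (List; []; _∷_; _++_; length; map; filter; drop; head; allFin)
open import Data.List.Membership.Propositional using (_∈_; _∉_)
open import Data.List.Membership.Propositional.Properties
  using (∈-map⁺; ∈-map⁻; ∈-filter⁺; ∈-filter⁻; ∈-++⁺ˡ; ∈-++⁺ʳ; ∈-++⁻)
open import Data.List.Membership.DecPropositional (_≟_ {3}) using (_∈?_)
open import Data.List.Properties using (length-map; length-filter; length-++; map-cong-local)
import Data.List.Relation.Unary.All as All
open import Data.List.Relation.Unary.All.Properties using (all-filter)
open import Data.List.Relation.Unary.Any using (here; there)
open import Data.Maybe using (Maybe; just; nothing; fromMaybe)
open import Data.Maybe.Properties using (≡-dec; just-injective)
open import Data.Nat as ℕ using (ℕ; zero; suc; _+_; _≤_; z≤n; s≤s)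
open import Data.Nat.Properties
  using (≤-pred; ≤-trans; ≤-refl; <-≤-trans; <-irrelevant; +-mono-≤) renaming (<-asym to ℕ-<-asym)
open import Data.Product using (Σ; ∃; _×_; _,_; proj₁; proj₂)
open import Data.Sum using (_⊎_; inj₁; inj₂)
open import Data.Vec using (_∷_; [])
open import Function using (_∘_; case_of_)
open import Relation.Binary using (tri<; tri≈; tri>)
open import Relation.Binary.Construct.Closure.ReflexiveTransitive using (Star; ε; _◅_)
open import Relation.Binary.PropositionalEquality
open import Relation.Nullary using (¬_; Dec; yes; no; does; ¬?; _×-dec_; _⊎-dec_; _→-dec_; T?)
open import Relation.Nullary.Decidable using (toWitness; dec-true; dec-false)
open import Relation.Unary using (Decidable)

-- Packing edge colourings from colourings of adjacent pairs

module Adjacency (G : Graph) where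

  infix 4 _~_ _~⁼_

  _~_ : Vertex G → Vertex G → Set
  x ~ y = Adj G x y

  _~⁼_ : Vertex G → Vertex G → Set
  x ~⁼ y = x ≡ y ⊎ x ~ y

  ~-sym : ∀ {x y} → x ~ y → y ~ x
  ~-sym {x} {y} x~y = trans (adj-sym G y x) x~y

  ~-irrefl : ∀ {x y} → x ~ y → x ≢ y
  ~-irrefl {x} x~x refl with trans (sym x~x) (irrefl G x)
  ... | ()

  ~⁼-sym : ∀ {x y} → x ~⁼ y → y ~⁼ x
  ~⁼-sym (inj₁ x≡y) = inj₁ (sym x≡y)
  ~⁼-sym (inj₂ x~y) = inj₂ (~-sym x~y)

module SparseColouring (G : Graph) where

  open Adjacency G

  infix 4 _∈ᵉ_

  _∈ᵉ_ : Vertex G → Edge G → Set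
  x ∈ᵉ e = _∈ₑ_ {G} x e

  ShareEnd : Vertex G → Vertex G → Vertex G → Vertex G → Set
  ShareEnd u₁ u₂ v₁ v₂ = u₁ ≡ v₁ ⊎ u₁ ≡ v₂ ⊎ u₂ ≡ v₁ ⊎ u₂ ≡ v₂

  record IsSparseColouring (colour : Vertex G → Vertex G → Fin 4) : Set where
    field
      symmetric : ∀ {x y} → x ~ y → colour x y ≡ colour y x
      proper    : ∀ {x y z} → x ~ y → x ~ z → y ≢ z → colour x y ≢ colour x z
      sparse    : ∀ {u₁ u₂ v₁ v₂ w} → u₁ ~ u₂ → colour u₁ u₂ ≡ 3F → v₁ ~ v₂ → colour v₁ v₂ ≡ 3F →
                  u₁ ~⁼ w → w ~⁼ v₁ → ShareEnd u₁ u₂ v₁ v₂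

  edge-≡ : (e f : Edge G) → end₁ {G} e ≡ end₁ {G} f → end₂ {G} e ≡ end₂ {G} f → e ≡ f
  edge-≡ ((a , b) , a<b , a~b) ((.a , .b) , a<b′ , a~b′) refl refl
    rewrite <-irrelevant a<b a<b′ | Decidable⇒UIP.≡-irrelevant _≟ᵇ_ a~b a~b′ = refl

  record OtherEnd (x : Vertex G) (e : Edge G) : Set where
    field
      y    : Vertex G
      x~y  : x ~ y
      ends : (x ≡ end₁ {G} e × y ≡ end₂ {G} e) ⊎ (x ≡ end₂ {G} e × y ≡ end₁ {G} e)

  otherEnd : ∀ {x} e → x ∈ᵉ e → OtherEnd x e
  otherEnd e (inj₁ refl) = record { y = end₂ {G} e ; x~y = proj₂ (proj₂ e) ; ends = inj₁ (refl , refl) }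
  otherEnd e (inj₂ refl) = record { y = end₁ {G} e ; x~y = ~-sym (proj₂ (proj₂ e)) ; ends = inj₂ (refl , refl) }

  otherEnd-∈ᵉ : ∀ {x e} (o : OtherEnd x e) → OtherEnd.y o ∈ᵉ e
  otherEnd-∈ᵉ o with OtherEnd.ends o
  ... | inj₁ (_ , y≡) = inj₂ y≡
  ... | inj₂ (_ , y≡) = inj₁ y≡

  otherEnd-injective : ∀ {x e f} (o : OtherEnd x e) (o′ : OtherEnd x f) → OtherEnd.y o ≡ OtherEnd.y o′ → e ≡ f
  otherEnd-injective {e = e} {f} o o′ y≡y′ with OtherEnd.ends o | OtherEnd.ends o′
  ... | inj₁ (a , b) | inj₁ (c , d) = edge-≡ e f (trans (sym a) c) (trans (sym b) (trans y≡y′ d))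
  ... | inj₂ (a , b) | inj₂ (c , d) = edge-≡ e f (trans (sym b) (trans y≡y′ d)) (trans (sym a) c)
  ... | inj₁ (a , b) | inj₂ (c , d) = ⊥-elim (ℕ-<-asym (proj₁ (proj₂ e))
          (subst₂ (λ u v → toℕ u ℕ.< toℕ v) (trans (sym d) (trans (sym y≡y′) b)) (trans (sym c) a) (proj₁ (proj₂ f))))
  ... | inj₂ (a , b) | inj₁ (c , d) = ⊥-elim (ℕ-<-asym (proj₁ (proj₂ e))
          (subst₂ (λ u v → toℕ u ℕ.< toℕ v) (trans (sym c) a) (trans (sym d) (trans (sym y≡y′) b)) (proj₁ (proj₂ f))))

  ∈ᵉ-~⁼ : ∀ {x y} e → x ∈ᵉ e → y ∈ᵉ e → x ~⁼ y
  ∈ᵉ-~⁼ e (inj₁ refl) (inj₁ refl) = inj₁ refl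
  ∈ᵉ-~⁼ e (inj₁ refl) (inj₂ refl) = inj₂ (proj₂ (proj₂ e))
  ∈ᵉ-~⁼ e (inj₂ refl) (inj₁ refl) = inj₂ (~-sym (proj₂ (proj₂ e)))
  ∈ᵉ-~⁼ e (inj₂ refl) (inj₂ refl) = inj₁ refl

  record Near (e f : Edge G) : Set where
    field
      x w y : Vertex G
      x∈e   : x ∈ᵉ e
      y∈f   : y ∈ᵉ f
      x~⁼w  : x ~⁼ w
      w~⁼y  : w ~⁼ y

  near : ∀ {e f k} → k ≤ 2 → LWalk G e f (suc k) → Near e f
  near _ (step (_ , x , x∈e , x∈f) here) =
    record { x = x ; w = x ; y = x ; x∈e = x∈e ; y∈f = x∈f ; x~⁼w = inj₁ refl ; w~⁼y = inj₁ refl }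
  near _ (step {f = g} (_ , x , x∈e , x∈g) (step (_ , y , y∈g , y∈f) here)) =
    record { x = x ; w = y ; y = y ; x∈e = x∈e ; y∈f = y∈f ; x~⁼w = ∈ᵉ-~⁼ g x∈g y∈g ; w~⁼y = inj₁ refl }
  near _ (step {f = g} (_ , x , x∈e , x∈g) (step {f = h} (_ , y , y∈g , y∈h) (step (_ , z , z∈h , z∈f) here))) =
    record { x = x ; w = y ; y = z ; x∈e = x∈e ; y∈f = z∈f ; x~⁼w = ∈ᵉ-~⁼ g x∈g y∈g ; w~⁼y = ∈ᵉ-~⁼ h y∈h z∈h }
  near (s≤s (s≤s ())) (step _ (step _ (step _ (step _ _))))

  module _ {colour : Vertex G → Vertex G → Fin 4} (isSparse : IsSparseColouring colour) where

    open IsSparseColouring isSparse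

    edgeColour : Edge G → Fin 4
    edgeColour e = colour (end₁ {G} e) (end₂ {G} e)

    edgeColour-otherEnd : ∀ {x e} (o : OtherEnd x e) → edgeColour e ≡ colour x (OtherEnd.y o)
    edgeColour-otherEnd {e = e} o with OtherEnd.ends o
    ... | inj₁ (refl , refl) = refl
    ... | inj₂ (refl , refl) = symmetric (proj₂ (proj₂ e))

    edgeColour-proper : ∀ {x} e f → x ∈ᵉ e → x ∈ᵉ f → e ≢ f → edgeColour e ≢ edgeColour f
    edgeColour-proper e f x∈e x∈f e≢f same =
      let o = otherEnd e x∈e ; o′ = otherEnd f x∈f in
      proper (OtherEnd.x~y o) (OtherEnd.x~y o′) (λ y≡y′ → e≢f (otherEnd-injective o o′ y≡y′))
        (trans (sym (edgeColour-otherEnd o)) (trans same (edgeColour-otherEnd o′)))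

    shareEnd-common : ∀ {x y e f} → x ∈ᵉ e → y ∈ᵉ f → (o : OtherEnd x e) (o′ : OtherEnd y f) →
                      ShareEnd x (OtherEnd.y o) y (OtherEnd.y o′) → Σ (Vertex G) λ z → z ∈ᵉ e × z ∈ᵉ f
    shareEnd-common x∈e y∈f o o′ (inj₁ refl) = _ , x∈e , y∈f
    shareEnd-common x∈e y∈f o o′ (inj₂ (inj₁ refl)) = _ , x∈e , otherEnd-∈ᵉ o′
    shareEnd-common x∈e y∈f o o′ (inj₂ (inj₂ (inj₁ refl))) = _ , otherEnd-∈ᵉ o , y∈f
    shareEnd-common x∈e y∈f o o′ (inj₂ (inj₂ (inj₂ refl))) = _ , otherEnd-∈ᵉ o , otherEnd-∈ᵉ o′

    sparse-far : ∀ {e f} → e ≢ f → edgeColour e ≡ 3F → edgeColour f ≡ 3F → Near e f → ⊥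
    sparse-far {e} {f} e≢f e↦3 f↦3 n =
      let open Near n
          o = otherEnd e x∈e ; o′ = otherEnd f y∈f
          (z , z∈e , z∈f) = shareEnd-common x∈e y∈f o o′
            (sparse (OtherEnd.x~y o) (trans (sym (edgeColour-otherEnd o)) e↦3)
                    (OtherEnd.x~y o′) (trans (sym (edgeColour-otherEnd o′)) f↦3) x~⁼w w~⁼y)
      in edgeColour-proper e f z∈e z∈f e≢f (trans e↦3 (sym f↦3))

    adjacent-far : ∀ {e f k} → e ≢ f → edgeColour e ≡ edgeColour f → suc k ≤ 1 → LWalk G e f (suc k) → ⊥
    adjacent-far {e} {f} e≢f same (s≤s z≤n) (step (_ , x , x∈e , x∈f) here) = edgeColour-proper e f x∈e x∈f e≢f same

    isPacking : IsPackingEdgeColoring G (1 ∷ 1 ∷ 1 ∷ 3 ∷ []) edgeColour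
    isPacking e f e≢f same (zero , _ , here) = e≢f refl
    isPacking e f e≢f same (suc k , k<s , walk) with edgeColour e in e↦
    ... | 0F = adjacent-far e≢f (trans e↦ same) k<s walk
    ... | 1F = adjacent-far e≢f (trans e↦ same) k<s walk
    ... | 2F = adjacent-far e≢f (trans e↦ same) k<s walk
    ... | 3F = sparse-far e≢f e↦ (sym same) (near (≤-pred k<s) walk)

    packingEdgeColorable : PackingEdgeColorable G (1 ∷ 1 ∷ 1 ∷ 3 ∷ [])
    packingEdgeColorable = edgeColour , isPacking

-- Greedy constructions along the vertex order

module Greedy {n : ℕ} {A : Set} (conflicts : Fin n → List (Fin n)) (choose : Fin n → List A → A) where

  earlierValues : (Fin n → A) → Fin n → List A
  earlierValues f x = map f (filter (_<? x) (conflicts x))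

  earlierValues-cong : ∀ {f g} x → (∀ {y} → y < x → f y ≡ g y) → earlierValues f x ≡ earlierValues g x
  earlierValues-cong x f≗g = map-cong-local (All.map f≗g (all-filter (_<? x) (conflicts x)))

  earlierValues-length : ∀ f x → length (earlierValues f x) ≤ length (conflicts x)
  earlierValues-length f x rewrite length-map f (filter (_<? x) (conflicts x)) = length-filter (_<? x) (conflicts x)

  greedyWithin : ℕ → Fin n → A
  greedyWithin zero    x = choose x []
  greedyWithin (suc k) x = choose x (earlierValues (greedyWithin k) x)

  greedyWithin-stable : ∀ k l y → toℕ y ℕ.< k → toℕ y ℕ.< l → greedyWithin k y ≡ greedyWithin l y
  greedyWithin-stable (suc k) (suc l) y (s≤s y<k) (s≤s y<l) =
    cong (choose y) (earlierValues-cong y λ {z} z<y →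
      greedyWithin-stable k l z (<-≤-trans z<y y<k) (<-≤-trans z<y y<l))

  greedy : Fin n → A
  greedy x = greedyWithin (suc (toℕ x)) x

  greedy-unfold : ∀ x → greedy x ≡ choose x (earlierValues greedy x)
  greedy-unfold x = cong (choose x) (earlierValues-cong x λ {z} z<x →
    greedyWithin-stable (toℕ x) (suc (toℕ z)) z z<x ≤-refl)

  greedy-sees : ∀ {x y} → y ∈ conflicts x → x ∈ conflicts y → x ≢ y →
                greedy y ∈ earlierValues greedy x ⊎ greedy x ∈ earlierValues greedy y
  greedy-sees {x} {y} y∈ x∈ x≢y with <-cmp x y
  ... | tri< x<y _ _ = inj₂ (∈-map⁺ greedy (∈-filter⁺ (_<? y) x∈ x<y))
  ... | tri≈ _ x≡y _ = ⊥-elim (x≢y x≡y)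
  ... | tri> _ _ y<x = inj₁ (∈-map⁺ greedy (∈-filter⁺ (_<? x) y∈ y<x))

or-∈ : ∀ {bs} → true ∈ bs → or bs ≡ true
or-∈ (here refl) = refl
or-∈ {b ∷ _} (there t∈) with b
... | true  = refl
... | false = or-∈ t∈

∈-or : ∀ bs → or bs ≡ true → true ∈ bs
∈-or (true ∷ bs)  _  = here refl
∈-or (false ∷ bs) eq = there (∈-or bs eq)

module MaximalIndependentSet {n : ℕ} (conflicts : Fin n → List (Fin n)) (candidate : Fin n → Bool) where

  open Greedy conflicts (λ x bs → candidate x ∧ not (or bs))

  abstract
    selected : Fin n → Bool
    selected = greedy

    selected⇒candidate : ∀ {x} → selected x ≡ true → candidate x ≡ true
    selected⇒candidate {x} sel with candidate x | trans (sym sel) (greedy-unfold x)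
    ... | true | _ = refl

    selected-sees-none : ∀ {x} → selected x ≡ true → true ∉ earlierValues greedy x
    selected-sees-none {x} sel t∈ with candidate x | trans (sym sel) (greedy-unfold x)
    ... | true | eq rewrite or-∈ t∈ with eq
    ... | ()

    selected-independent : ∀ {x y} → y ∈ conflicts x → x ∈ conflicts y → x ≢ y →
                           selected x ≡ true → selected y ≡ true → ⊥
    selected-independent y∈ x∈ x≢y sx sy with greedy-sees y∈ x∈ x≢y
    ... | inj₁ sy∈ = selected-sees-none sx (subst (_∈ _) sy sy∈)
    ... | inj₂ sx∈ = selected-sees-none sy (subst (_∈ _) sx sx∈)

    selected-maximal : ∀ {x} → candidate x ≡ true → selected x ≡ false →
                       ∃ λ y → y ∈ conflicts x × selected y ≡ true
    selected-maximal {x} cand unsel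
      with ∈-map⁻ greedy (∈-or _ (some-earlier-selected cand (trans (sym (greedy-unfold x)) unsel)))
      where
      some-earlier-selected : ∀ {c b} → c ≡ true → c ∧ not b ≡ false → b ≡ true
      some-earlier-selected {b = true}  _    _  = refl
      some-earlier-selected {b = false} refl ()
    ... | y , y∈ , sel = y , proj₁ (∈-filter⁻ (_<? x) y∈) , sym sel

firstFree : List (Fin 3) → Fin 3
firstFree cs = if does (0F ∈? cs) then (if does (1F ∈? cs) then 2F else 1F) else 0F

firstFree-∉ : ∀ cs → length cs ≤ 2 → firstFree cs ∉ cs
firstFree-∉ []                _ = λ ()
firstFree-∉ (a ∷ [])          _ = toWitness {a? = all? λ a → ¬? (firstFree (a ∷ []) ∈? (a ∷ []))} _ a
firstFree-∉ (a ∷ b ∷ [])      _ =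
  toWitness {a? = all? λ a → all? λ b → ¬? (firstFree (a ∷ b ∷ []) ∈? (a ∷ b ∷ []))} _ a b
firstFree-∉ (_ ∷ _ ∷ _ ∷ _) (s≤s (s≤s ()))

module ThreeColouring {n : ℕ} (conflicts : Fin n → List (Fin n)) where

  open Greedy conflicts (λ _ → firstFree)

  abstract
    colour : Fin n → Fin 3
    colour = greedy

    colour-avoids : ∀ {x c} → length (conflicts x) ≤ 2 → c ∈ earlierValues greedy x → colour x ≢ c
    colour-avoids {x} deg c∈ refl =
      firstFree-∉ (earlierValues greedy x) (≤-trans (earlierValues-length greedy x) deg)
        (subst (_∈ earlierValues greedy x) (greedy-unfold x) c∈)

    colour-proper : ∀ {x y} → y ∈ conflicts x → x ∈ conflicts y → x ≢ y →
                    length (conflicts x) ≤ 2 → length (conflicts y) ≤ 2 → colour x ≢ colour y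
    colour-proper y∈ x∈ x≢y degx degy with greedy-sees y∈ x∈ x≢y
    ... | inj₁ cy∈ = colour-avoids degx cy∈
    ... | inj₂ cx∈ = λ eq → colour-avoids degy cx∈ (sym eq)

-- Local colouring rules, verified by exhaustive search

-- x<p, x<q and p<q are the comparisons between three distinct elements x, p, q of a linear order.
Consistent : Bool → Bool → Bool → Set
Consistent x<p x<q p<q = T (not (x<p ∧ p<q ∧ not x<q) ∧ not (not x<p ∧ x<q ∧ not p<q))

module _ {n : ℕ} where

  infix 6 _≺_

  _≺_ : Fin n → Fin n → Bool
  a ≺ b = does (a <? b)

  ≮⇒> : ∀ {a b : Fin n} → a ≢ b → ¬ a < b → b < a
  ≮⇒> {a} {b} a≢b a≮b with <-cmp a b
  ... | tri< a<b _ _ = ⊥-elim (a≮b a<b)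
  ... | tri≈ _ a≡b _ = ⊥-elim (a≢b a≡b)
  ... | tri> _ _ b<a = b<a

  private
    does-true : {A : Set} (d : Dec A) → does d ≡ true → A
    does-true (yes a) _ = a

    does-false : {A : Set} (d : Dec A) → does d ≡ false → ¬ A
    does-false (no ¬a) _ = ¬a

  ≺-true : ∀ {a b : Fin n} → a ≺ b ≡ true → a < b
  ≺-true {a} {b} = does-true (a <? b)

  ≺-false : ∀ {a b : Fin n} → a ≺ b ≡ false → ¬ a < b
  ≺-false {a} {b} = does-false (a <? b)

  ≺-flip : ∀ {a b : Fin n} → a ≢ b → b ≺ a ≡ not (a ≺ b)
  ≺-flip {a} {b} a≢b with <-cmp a b
  ... | tri< a<b _ _ = trans (dec-false (b <? a) (<-asym a<b)) (cong not (sym (dec-true (a <? b) a<b)))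
  ... | tri≈ _ a≡b _ = ⊥-elim (a≢b a≡b)
  ... | tri> _ _ b<a = trans (dec-true (b <? a) b<a) (cong not (sym (dec-false (a <? b) (<-asym b<a))))

  ≺-consistent : ∀ {a b c : Fin n} → a ≢ b → a ≢ c → b ≢ c → Consistent (a ≺ b) (a ≺ c) (b ≺ c)
  ≺-consistent {a} {b} {c} a≢b a≢c b≢c with a ≺ b in ab | a ≺ c in ac | b ≺ c in bc
  ... | true  | true  | true  = _
  ... | true  | true  | false = _
  ... | true  | false | true  = ≺-false {a} {c} ac (<-trans (≺-true {a} {b} ab) (≺-true {b} {c} bc))
  ... | true  | false | false = _
  ... | false | true  | true  = _
  ... | false | true  | false =
    <-irrefl refl (<-trans (<-trans (≮⇒> a≢b (≺-false {a} {b} ab)) (≺-true {a} {c} ac)) (≮⇒> b≢c (≺-false {b} {c} bc)))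
  ... | false | false | true  = _
  ... | false | false | false = _

all-Bool? : {P : Bool → Set} → Decidable P → Dec (∀ b → P b)
all-Bool? P? with P? false | P? true
... | yes f | yes t = yes λ { false → f ; true → t }
... | no ¬f | _     = no λ h → ¬f (h false)
... | _     | no ¬t = no λ h → ¬t (h true)

all-Maybe? : ∀ {k} {P : Maybe (Fin k) → Set} → Decidable P → Dec (∀ m → P m)
all-Maybe? P? with P? nothing | all? (λ a → P? (just a))
... | yes n | yes j = yes λ { nothing → n ; (just a) → j a }
... | no ¬n | _     = no λ h → ¬n (h nothing)
... | _     | no ¬j = no λ h → ¬j (λ a → h (just a))

nextColour : Fin 3 → Fin 3
nextColour 0F = 1F
nextColour 1F = 2F
nextColour 2F = 0F

thirdColour : Fin 3 → Fin 3 → Fin 3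
thirdColour 0F 1F = 2F
thirdColour 1F 0F = 2F
thirdColour 0F 2F = 1F
thirdColour 2F 0F = 1F
thirdColour _  _  = 0F

-- Colour of the edge uv of a free triangle uvw from the link colours at u, v, w and whether u and v precede w;
-- 3F is used exactly when the colours 0F–2F cannot be completed around the triangle.
freeTriangleEdgeColour : Fin 3 → Fin 3 → Fin 3 → Bool → Bool → Fin 4
freeTriangleEdgeColour lu lv lw u<w v<w with lu ≟ lv | lu ≟ lw | lv ≟ lw
... | yes _ | yes _ | _     =
  if u<w ∧ v<w then 3F else inject₁ (if u<w ∨ v<w then nextColour (nextColour lw) else nextColour lw)
... | yes _ | no _  | _     = inject₁ lw
... | no _  | yes _ | _     = if u<w then 3F else inject₁ (thirdColour lu lv)
... | no _  | no _  | yes _ = if v<w then 3F else inject₁ (thirdColour lu lv)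
... | no _  | no _  | no _  = inject₁ lw

freeTriangleEdgeColour-sym : ∀ lu lv lw u<w v<w →
  freeTriangleEdgeColour lu lv lw u<w v<w ≡ freeTriangleEdgeColour lv lu lw v<w u<w
freeTriangleEdgeColour-sym = toWitness {a? = all? λ lu → all? λ lv → all? λ lw → all-Bool? λ b → all-Bool? λ c →
  freeTriangleEdgeColour lu lv lw b c ≟ freeTriangleEdgeColour lv lu lw c b} _

freeTriangleEdgeColour-proper : ∀ lx lp lq x<p x<q p<q → Consistent x<p x<q p<q →
  let c₁ = freeTriangleEdgeColour lx lp lq x<q p<q
      c₂ = freeTriangleEdgeColour lx lq lp x<p (not p<q)
  in c₁ ≢ c₂ × c₁ ≢ inject₁ lx × c₂ ≢ inject₁ lx
freeTriangleEdgeColour-proper = toWitness {a? = all? λ lx → all? λ lp → all? λ lq →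
  all-Bool? λ b₁ → all-Bool? λ b₂ → all-Bool? λ b₃ → T? _ →-dec
    (let c₁ = freeTriangleEdgeColour lx lp lq b₂ b₃
         c₂ = freeTriangleEdgeColour lx lq lp b₁ (not b₃)
     in ¬? (c₁ ≟ c₂) ×-dec ¬? (c₁ ≟ inject₁ lx) ×-dec ¬? (c₂ ≟ inject₁ lx))} _

-- Colour of an edge t m of a diamond with tips t, t′ and middle vertices m, m′, from the link colours at t and t′;
-- the bit is (t precedes t′) xor (m precedes m′).
diamondEdgeColour : Fin 3 → Fin 3 → Bool → Fin 3
diamondEdgeColour lt lt′ s with lt ≟ lt′
... | yes _ = if s then nextColour (nextColour lt) else nextColour lt
... | no _  = if s then thirdColour lt lt′ else lt′

diamondEdgeColour-proper : ∀ lt lt′ s →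
  diamondEdgeColour lt lt′ s ≢ diamondEdgeColour lt′ lt (not s) ×
  diamondEdgeColour lt lt′ s ≢ diamondEdgeColour lt lt′ (not s) ×
  diamondEdgeColour lt lt′ s ≢ lt
diamondEdgeColour-proper = toWitness {a? = all? λ lt → all? λ lt′ → all-Bool? λ s →
  ¬? (diamondEdgeColour lt lt′ s ≟ diamondEdgeColour lt′ lt (not s)) ×-dec
  ¬? (diamondEdgeColour lt lt′ s ≟ diamondEdgeColour lt lt′ (not s)) ×-dec
  ¬? (diamondEdgeColour lt lt′ s ≟ lt)} _

_≟ᴹ_ : (a b : Maybe (Fin 3)) → Dec (a ≡ b)
_≟ᴹ_ = ≡-dec _≟_

unprescribed : Maybe (Fin 3) → Maybe (Fin 3) → List (Fin 3)
unprescribed sp sq = filter (λ c → ¬? (just c ≟ᴹ sp) ×-dec ¬? (just c ≟ᴹ sq)) (allFin 3)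

smallerUnprescribed : Maybe (Fin 3) → Bool → ℕ
smallerUnprescribed nothing  false = 1
smallerUnprescribed _        _     = 0

-- Link colour at x in a non-free triangle x p q with prescribed colours sx, sp, sq: an unprescribed x takes the
-- k-th colour prescribed to neither mate, where k counts the unprescribed mates preceding x.
completedLinkColour : Maybe (Fin 3) → Maybe (Fin 3) → Maybe (Fin 3) → Bool → Bool → Fin 3
completedLinkColour (just c) _  _  _   _   = c
completedLinkColour nothing  sp sq x<p x<q =
  fromMaybe 0F (head (drop (smallerUnprescribed sp x<p + smallerUnprescribed sq x<q) (unprescribed sp sq)))

completedLinkColour-swap : ∀ s sp sq x<p x<q →
  completedLinkColour s sp sq x<p x<q ≡ completedLinkColour s sq sp x<q x<p
completedLinkColour-swap = toWitness {a? = all-Maybe? λ s → all-Maybe? λ sp → all-Maybe? λ sq →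
  all-Bool? λ x<p → all-Bool? λ x<q → completedLinkColour s sp sq x<p x<q ≟ completedLinkColour s sq sp x<q x<p} _

Compatible : Maybe (Fin 3) → Maybe (Fin 3) → Set
Compatible s t = s ≡ nothing ⊎ s ≢ t

completedLinkColour-proper : ∀ sx sp sq x<p x<q p<q → Consistent x<p x<q p<q →
  sx ≡ nothing ⊎ sp ≡ nothing ⊎ sq ≡ nothing →
  Compatible sx sp → Compatible sx sq → Compatible sp sq →
  let cx = completedLinkColour sx sp sq x<p x<q
      cp = completedLinkColour sp sx sq (not x<p) p<q
      cq = completedLinkColour sq sx sp (not x<q) (not p<q)
  in cx ≢ cp × cx ≢ cq × cp ≢ cq
completedLinkColour-proper = toWitness {a? = all-Maybe? λ sx → all-Maybe? λ sp → all-Maybe? λ sq →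
  all-Bool? λ x<p → all-Bool? λ x<q → all-Bool? λ p<q →
    T? _ →-dec (sx ≟ᴹ nothing ⊎-dec sp ≟ᴹ nothing ⊎-dec sq ≟ᴹ nothing) →-dec
    compatible? sx sp →-dec compatible? sx sq →-dec compatible? sp sq →-dec
    (let cx = completedLinkColour sx sp sq x<p x<q
         cp = completedLinkColour sp sx sq (not x<p) p<q
         cq = completedLinkColour sq sx sp (not x<q) (not p<q)
     in ¬? (cx ≟ cp) ×-dec ¬? (cx ≟ cq) ×-dec ¬? (cp ≟ cq))} _
  where
  compatible? : ∀ s t → Dec (Compatible s t)
  compatible? s t = s ≟ᴹ nothing ⊎-dec ¬? (s ≟ᴹ t)

-- The colour classes are the three perfect matchings of K₄.
k4EdgeColour : Fin 4 → Fin 4 → Fin 3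
k4EdgeColour 0F 1F = 0F
k4EdgeColour 1F 0F = 0F
k4EdgeColour 2F 3F = 0F
k4EdgeColour 3F 2F = 0F
k4EdgeColour 0F 2F = 1F
k4EdgeColour 2F 0F = 1F
k4EdgeColour 1F 3F = 1F
k4EdgeColour 3F 1F = 1F
k4EdgeColour _  _  = 2F

k4EdgeColour-sym : ∀ i j → k4EdgeColour i j ≡ k4EdgeColour j i
k4EdgeColour-sym = toWitness {a? = all? λ i → all? λ j → k4EdgeColour i j ≟ k4EdgeColour j i} _

k4EdgeColour-proper : ∀ i j k → i ≢ j → i ≢ k → j ≢ k → k4EdgeColour i j ≢ k4EdgeColour i k
k4EdgeColour-proper = toWitness {a? = all? λ i → all? λ j → all? λ k →
  ¬? (i ≟ j) →-dec ¬? (i ≟ k) →-dec ¬? (j ≟ k) →-dec ¬? (k4EdgeColour i j ≟ k4EdgeColour i k)} _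

-- Local structure of claw-free cubic graphs

infix 4 _∈⟨_,_,_⟩

_∈⟨_,_,_⟩ : {A : Set} → A → A → A → A → Set
w ∈⟨ a , b , c ⟩ = w ≡ a ⊎ w ≡ b ⊎ w ≡ c

pattern first  = inj₁ refl
pattern second = inj₂ (inj₁ refl)
pattern third  = inj₂ (inj₂ refl)

module _ {A : Set} {a b c x y z : A} where

  private
    pigeonhole : x ≡ b ⊎ x ≡ c → y ≡ b ⊎ y ≡ c → z ≡ b ⊎ z ≡ c → x ≢ y → x ≢ z → y ≢ z → ⊥
    pigeonhole (inj₁ refl) (inj₁ refl) _           x≢y _   _   = x≢y refl
    pigeonhole (inj₂ refl) (inj₂ refl) _           x≢y _   _   = x≢y refl
    pigeonhole (inj₁ refl) _           (inj₁ refl) _   x≢z _   = x≢z refl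
    pigeonhole (inj₂ refl) _           (inj₂ refl) _   x≢z _   = x≢z refl
    pigeonhole _           (inj₁ refl) (inj₁ refl) _   _   y≢z = y≢z refl
    pigeonhole _           (inj₂ refl) (inj₂ refl) _   _   y≢z = y≢z refl

  ∈⟨⟩-covers-first : x ∈⟨ a , b , c ⟩ → y ∈⟨ a , b , c ⟩ → z ∈⟨ a , b , c ⟩ → x ≢ y → x ≢ z → y ≢ z →
                     a ∈⟨ x , y , z ⟩
  ∈⟨⟩-covers-first first _     _     _ _ _ = first
  ∈⟨⟩-covers-first _     first _     _ _ _ = second
  ∈⟨⟩-covers-first _     _     first _ _ _ = third
  ∈⟨⟩-covers-first (inj₂ x∈) (inj₂ y∈) (inj₂ z∈) x≢y x≢z y≢z = ⊥-elim (pigeonhole x∈ y∈ z∈ x≢y x≢z y≢z)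

∈⟨⟩-rotate : {A : Set} {w a b c : A} → w ∈⟨ a , b , c ⟩ → w ∈⟨ b , c , a ⟩
∈⟨⟩-rotate (inj₁ w≡a)        = inj₂ (inj₂ w≡a)
∈⟨⟩-rotate (inj₂ (inj₁ w≡b)) = inj₁ w≡b
∈⟨⟩-rotate (inj₂ (inj₂ w≡c)) = inj₂ (inj₁ w≡c)

∈⟨⟩-permute : {A : Set} {a b c x y z w : A} →
              x ∈⟨ a , b , c ⟩ → y ∈⟨ a , b , c ⟩ → z ∈⟨ a , b , c ⟩ → x ≢ y → x ≢ z → y ≢ z →
              w ∈⟨ a , b , c ⟩ → w ∈⟨ x , y , z ⟩
∈⟨⟩-permute x∈ y∈ z∈ x≢y x≢z y≢z (inj₁ refl) = ∈⟨⟩-covers-first x∈ y∈ z∈ x≢y x≢z y≢z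
∈⟨⟩-permute x∈ y∈ z∈ x≢y x≢z y≢z (inj₂ (inj₁ refl)) =
  ∈⟨⟩-covers-first (∈⟨⟩-rotate x∈) (∈⟨⟩-rotate y∈) (∈⟨⟩-rotate z∈) x≢y x≢z y≢z
∈⟨⟩-permute x∈ y∈ z∈ x≢y x≢z y≢z (inj₂ (inj₂ refl)) =
  ∈⟨⟩-covers-first (∈⟨⟩-rotate (∈⟨⟩-rotate x∈)) (∈⟨⟩-rotate (∈⟨⟩-rotate y∈)) (∈⟨⟩-rotate (∈⟨⟩-rotate z∈))
    x≢y x≢z y≢z

∈⟨⟩⇒∈ : {A : Set} {w a b c : A} → w ∈⟨ a , b , c ⟩ → w ∈ a ∷ b ∷ c ∷ []
∈⟨⟩⇒∈ (inj₁ w≡)        = here w≡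
∈⟨⟩⇒∈ (inj₂ (inj₁ w≡)) = there (here w≡)
∈⟨⟩⇒∈ (inj₂ (inj₂ w≡)) = there (there (here w≡))

∈⇒∈⟨⟩ : {A : Set} {w a b c : A} → w ∈ a ∷ b ∷ c ∷ [] → w ∈⟨ a , b , c ⟩
∈⇒∈⟨⟩ (here w≡)                 = inj₁ w≡
∈⇒∈⟨⟩ (there (here w≡))         = inj₂ (inj₁ w≡)
∈⇒∈⟨⟩ (there (there (here w≡))) = inj₂ (inj₂ w≡)

module ClawFreeCubic (G : Graph) (cubic : Cubic G) (clawFree : ClawFree G) where

  open Adjacency G

  private
    V = Vertex G

  _~?_ : ∀ x y → Dec (x ~ y)
  x ~? y = adj G x y ≟ᵇ true

  record Neighbours (v : V) : Set where
    field
      a b c    : V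
      a≢b      : a ≢ b
      a≢c      : a ≢ c
      b≢c      : b ≢ c
      ~a       : v ~ a
      ~b       : v ~ b
      ~c       : v ~ c
      complete : ∀ {w} → v ~ w → w ∈⟨ a , b , c ⟩

  neighbours : ∀ v → Neighbours v
  neighbours v =
    let (a , b , c , a≢b , a≢c , b≢c , ~a , ~b , ~c , complete) = cubic v
    in record { a = a ; b = b ; c = c ; a≢b = a≢b ; a≢c = a≢c ; b≢c = b≢c
              ; ~a = ~a ; ~b = ~b ; ~c = ~c ; complete = λ {w} → complete w }

  neighbours-complete : ∀ {v x y z} → v ~ x → v ~ y → v ~ z → x ≢ y → x ≢ z → y ≢ z →
                        ∀ {w} → v ~ w → w ∈⟨ x , y , z ⟩
  neighbours-complete {v} v~x v~y v~z x≢y x≢z y≢z v~w =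
    ∈⟨⟩-permute (complete v~x) (complete v~y) (complete v~z) x≢y x≢z y≢z (complete v~w)
    where open Neighbours (neighbours v)

  TriangularNeighbourhood : V → Set
  TriangularNeighbourhood v = a ~ b × a ~ c × b ~ c
    where open Neighbours (neighbours v)

  triangularNeighbourhood? : ∀ v → Dec (TriangularNeighbourhood v)
  triangularNeighbourhood? v = (a ~? b) ×-dec (a ~? c) ×-dec (b ~? c)
    where open Neighbours (neighbours v)

  -- For a vertex v with `isMid v`, the neighbours x₁ v, x₂ v, x₃ v induce a path x₂ – x₁ – x₃:
  -- v and x₁ v are the middle vertices of a diamond (K₄ minus an edge) whose tips are x₂ v and x₃ v.
  -- Otherwise v, x₁ v, x₂ v form a triangle and x₃ v is the only neighbour of v outside it.
  record Shape (v : V) : Set where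
    field
      isMid    : Bool
      x₁ x₂ x₃ : V
      ~x₁      : v ~ x₁
      ~x₂      : v ~ x₂
      ~x₃      : v ~ x₃
      x₁≢x₂    : x₁ ≢ x₂
      x₁≢x₃    : x₁ ≢ x₃
      x₂≢x₃    : x₂ ≢ x₃
      complete : ∀ {w} → v ~ w → w ∈⟨ x₁ , x₂ , x₃ ⟩
      x₁~x₂    : x₁ ~ x₂
      x₂≁x₃    : ¬ x₂ ~ x₃
      x₁~x₃    : isMid ≡ true → x₁ ~ x₃
      x₁≁x₃    : isMid ≡ false → ¬ x₁ ~ x₃

  private
    shapeFrom : ∀ {v x₁ x₂ x₃} (N : Neighbours v) mid → let open Neighbours N in
                x₁ ∈⟨ a , b , c ⟩ → x₂ ∈⟨ a , b , c ⟩ → x₃ ∈⟨ a , b , c ⟩ → x₁ ≢ x₂ → x₁ ≢ x₃ → x₂ ≢ x₃ →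
                x₁ ~ x₂ → ¬ x₂ ~ x₃ → (mid ≡ true → x₁ ~ x₃) → (mid ≡ false → ¬ x₁ ~ x₃) → Shape v
    shapeFrom N mid x₁∈ x₂∈ x₃∈ x₁≢x₂ x₁≢x₃ x₂≢x₃ x₁~x₂ x₂≁x₃ x₁~x₃ x₁≁x₃ = record
      { isMid = mid ; ~x₁ = neighbour-~ x₁∈ ; ~x₂ = neighbour-~ x₂∈ ; ~x₃ = neighbour-~ x₃∈
      ; x₁≢x₂ = x₁≢x₂ ; x₁≢x₃ = x₁≢x₃ ; x₂≢x₃ = x₂≢x₃
      ; complete = λ v~w → ∈⟨⟩-permute x₁∈ x₂∈ x₃∈ x₁≢x₂ x₁≢x₃ x₂≢x₃ (complete v~w)
      ; x₁~x₂ = x₁~x₂ ; x₂≁x₃ = x₂≁x₃ ; x₁~x₃ = x₁~x₃ ; x₁≁x₃ = x₁≁x₃ }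
      where
      open Neighbours N
      neighbour-~ : ∀ {w} → w ∈⟨ a , b , c ⟩ → _ ~ w
      neighbour-~ (inj₁ refl)        = ~a
      neighbour-~ (inj₂ (inj₁ refl)) = ~b
      neighbour-~ (inj₂ (inj₂ refl)) = ~c

  module WithoutK₄ (noK₄ : ∀ v → ¬ TriangularNeighbourhood v) where

    private
      module _ (v : V) where
        open Neighbours (neighbours v)

        shapeBy : Dec (a ~ b) → Dec (a ~ c) → Dec (b ~ c) → Shape v
        shapeBy (yes a~b) (yes a~c) (yes b~c) = ⊥-elim (noK₄ v (a~b , a~c , b~c))
        shapeBy (yes a~b) (yes a~c) (no b≁c)  =
          shapeFrom (neighbours v) true first second third a≢b a≢c b≢c a~b b≁c (λ _ → a~c) λ ()
        shapeBy (yes a~b) (no a≁c)  (yes b~c) =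
          shapeFrom (neighbours v) true second first third (≢-sym a≢b) b≢c a≢c (~-sym a~b) a≁c (λ _ → b~c) λ ()
        shapeBy (no a≁b)  (yes a~c) (yes b~c) =
          shapeFrom (neighbours v) true third first second (≢-sym a≢c) (≢-sym b≢c) a≢b (~-sym a~c) a≁b
            (λ _ → ~-sym b~c) λ ()
        shapeBy (yes a~b) (no a≁c)  (no b≁c)  =
          shapeFrom (neighbours v) false first second third a≢b a≢c b≢c a~b b≁c (λ ()) λ _ → a≁c
        shapeBy (no a≁b)  (yes a~c) (no b≁c)  =
          shapeFrom (neighbours v) false first third second a≢c a≢b (≢-sym b≢c) a~c (b≁c ∘ ~-sym) (λ ()) λ _ → a≁b
        shapeBy (no a≁b)  (no a≁c)  (yes b~c) =
          shapeFrom (neighbours v) false second third first b≢c (≢-sym a≢b) (≢-sym a≢c) b~c (a≁c ∘ ~-sym) (λ ())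
            λ _ → a≁b ∘ ~-sym
        shapeBy (no a≁b)  (no a≁c)  (no b≁c)  =
          ⊥-elim (clawFree (v , a , b , c , a≢b , a≢c , b≢c , ~a , ~b , ~c , a≁b , a≁c , b≁c))

    abstract
      shape : ∀ v → Shape v
      shape v = shapeBy v (a ~? b) (a ~? c) (b ~? c)
        where open Neighbours (neighbours v)

    open module ShapeOf (v : V) = Shape (shape v)

    isMid-≢ : ∀ {x y} → isMid x ≡ true → isMid y ≡ false → x ≢ y
    isMid-≢ mx my refl with trans (sym mx) my
    ... | ()

    adjacentNeighbours-nonMid : ∀ {v x y} → isMid v ≡ false → v ~ x → v ~ y → x ~ y → x ≢ y →
                                (x ≡ x₁ v × y ≡ x₂ v) ⊎ (x ≡ x₂ v × y ≡ x₁ v)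
    adjacentNeighbours-nonMid {v} ¬mv v~x v~y x~y x≢y with complete v v~x | complete v v~y
    ... | first  | first  = ⊥-elim (x≢y refl)
    ... | first  | second = inj₁ (refl , refl)
    ... | first  | third  = ⊥-elim (x₁≁x₃ v ¬mv x~y)
    ... | second | first  = inj₂ (refl , refl)
    ... | second | second = ⊥-elim (x≢y refl)
    ... | second | third  = ⊥-elim (x₂≁x₃ v x~y)
    ... | third  | first  = ⊥-elim (x₁≁x₃ v ¬mv (~-sym x~y))
    ... | third  | second = ⊥-elim (x₂≁x₃ v (~-sym x~y))
    ... | third  | third  = ⊥-elim (x≢y refl)

    adjacentNeighbours-mid : ∀ {v x y} → isMid v ≡ true → v ~ x → v ~ y → x ~ y → x ≢ y → x ≡ x₁ v ⊎ y ≡ x₁ v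
    adjacentNeighbours-mid {v} mv v~x v~y x~y x≢y with complete v v~x | complete v v~y
    ... | inj₁ x≡ | _       = inj₁ x≡
    ... | _       | inj₁ y≡ = inj₂ y≡
    ... | second  | second  = ⊥-elim (x≢y refl)
    ... | second  | third   = ⊥-elim (x₂≁x₃ v x~y)
    ... | third   | second  = ⊥-elim (x₂≁x₃ v (~-sym x~y))
    ... | third   | third   = ⊥-elim (x≢y refl)

    partner-~ : ∀ {m w} → isMid m ≡ true → m ~ w → w ≢ x₁ m → x₁ m ~ w
    partner-~ {m} mm m~w w≢ with complete m m~w
    ... | inj₁ w≡  = ⊥-elim (w≢ w≡)
    ... | second   = x₁~x₂ m
    ... | third    = x₁~x₃ m mm

    partner-isMid : ∀ {v} → isMid v ≡ true → isMid (x₁ v) ≡ true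
    partner-isMid {v} mv with isMid (x₁ v) in m₁
    ... | true  = refl
    ... | false with adjacentNeighbours-nonMid m₁ (~-sym (~x₁ v)) (x₁~x₂ v) (~x₂ v) (~-irrefl (~x₂ v))
                   | adjacentNeighbours-nonMid m₁ (~-sym (~x₁ v)) (x₁~x₃ v mv) (~x₃ v) (~-irrefl (~x₃ v))
    ... | inj₁ (_ , p) | inj₁ (_ , q) = ⊥-elim (x₂≢x₃ v (trans p (sym q)))
    ... | inj₁ (p , _) | inj₂ (q , _) = ⊥-elim (x₁≢x₂ (x₁ v) (trans (sym p) q))
    ... | inj₂ (p , _) | inj₁ (q , _) = ⊥-elim (x₁≢x₂ (x₁ v) (trans (sym q) p))
    ... | inj₂ (_ , p) | inj₂ (_ , q) = ⊥-elim (x₂≢x₃ v (trans p (sym q)))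

    partner-involutive : ∀ {v} → isMid v ≡ true → x₁ (x₁ v) ≡ v
    partner-involutive {v} mv
      with adjacentNeighbours-mid (partner-isMid mv) (~-sym (~x₁ v)) (x₁~x₂ v) (~x₂ v) (~-irrefl (~x₂ v))
    ... | inj₁ v≡ = sym v≡
    ... | inj₂ x₂≡ = ⊥-elim (x₂≁x₃ v (subst (_~ x₃ v) (sym x₂≡)
                       (partner-~ (partner-isMid mv) (x₁~x₃ v mv) (λ x₃≡ → x₂≢x₃ v (trans x₂≡ (sym x₃≡))))))

    tip-nonMid : ∀ {m t} → isMid m ≡ true → m ~ t → t ≢ x₁ m → isMid t ≡ false
    tip-nonMid {m} {t} mm m~t t≢ with isMid t in mt
    ... | false = refl
    ... | true with adjacentNeighbours-mid mt (~-sym m~t) (~-sym (partner-~ mm m~t t≢)) (~x₁ m) (~-irrefl (~x₁ m))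
    ... | inj₁ m≡ = ⊥-elim (t≢ (trans (sym (partner-involutive mt)) (sym (cong x₁ m≡))))
    ... | inj₂ x₁m≡ = ⊥-elim (~-irrefl m~t (trans (sym (partner-involutive mm))
                        (trans (cong x₁ x₁m≡) (partner-involutive mt))))

    tip-mates : ∀ {m t} → isMid m ≡ true → m ~ t → t ≢ x₁ m →
                (m ≡ x₁ t × x₁ m ≡ x₂ t) ⊎ (m ≡ x₂ t × x₁ m ≡ x₁ t)
    tip-mates mm m~t t≢ =
      adjacentNeighbours-nonMid (tip-nonMid mm m~t t≢) (~-sym m~t) (~-sym (partner-~ mm m~t t≢)) (~x₁ _) (~-irrefl (~x₁ _))

    tip-partner₁ : ∀ {v} → isMid v ≡ false → isMid (x₁ v) ≡ true → x₁ (x₁ v) ≡ x₂ v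
    tip-partner₁ {v} ¬mv m₁ with adjacentNeighbours-mid m₁ (~-sym (~x₁ v)) (x₁~x₂ v) (~x₂ v) (~-irrefl (~x₂ v))
    ... | inj₁ v≡  = ⊥-elim (isMid-≢ (partner-isMid m₁) ¬mv (sym v≡))
    ... | inj₂ x₂≡ = sym x₂≡

    tip-partner₂ : ∀ {v} → isMid v ≡ false → isMid (x₂ v) ≡ true → x₁ (x₂ v) ≡ x₁ v
    tip-partner₂ {v} ¬mv m₂ with adjacentNeighbours-mid m₂ (~-sym (~x₂ v)) (~-sym (x₁~x₂ v)) (~x₁ v) (~-irrefl (~x₁ v))
    ... | inj₁ v≡  = ⊥-elim (isMid-≢ (partner-isMid m₂) ¬mv (sym v≡))
    ... | inj₂ x₁≡ = sym x₁≡

    mates-isMid : ∀ {v} → isMid v ≡ false → isMid (x₁ v) ≡ isMid (x₂ v)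
    mates-isMid {v} ¬mv with isMid (x₁ v) in m₁ | isMid (x₂ v) in m₂
    ... | true  | true  = refl
    ... | false | false = refl
    ... | true  | false = ⊥-elim (isMid-≢ (partner-isMid m₁) m₂ (tip-partner₁ ¬mv m₁))
    ... | false | true  = ⊥-elim (isMid-≢ (partner-isMid m₂) m₁ (tip-partner₂ ¬mv m₂))

    outer-nonMid : ∀ {v} → isMid v ≡ false → isMid (x₃ v) ≡ false
    outer-nonMid {v} ¬mv with isMid (x₃ v) in mo
    ... | false = refl
    ... | true with v ≟ x₁ (x₃ v)
    ... | yes v≡ = ⊥-elim (isMid-≢ (partner-isMid mo) ¬mv (sym v≡))
    ... | no v≢ with tip-mates mo (~-sym (~x₃ v)) v≢
    ... | inj₁ (x₃≡ , _) = ⊥-elim (x₁≢x₃ v (sym x₃≡))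
    ... | inj₂ (x₃≡ , _) = ⊥-elim (x₂≢x₃ v (sym x₃≡))

    outer-lonely : ∀ {v y} → isMid v ≡ false → v ~ y → x₃ v ~ y → ⊥
    outer-lonely {v} ¬mv v~y x₃~y with adjacentNeighbours-nonMid ¬mv (~x₃ v) v~y x₃~y (λ x₃≡y → ~-irrefl x₃~y x₃≡y)
    ... | inj₁ (x₃≡ , _) = x₁≢x₃ v (sym x₃≡)
    ... | inj₂ (x₃≡ , _) = x₂≢x₃ v (sym x₃≡)

    outer-involutive : ∀ {v} → isMid v ≡ false → x₃ (x₃ v) ≡ v
    outer-involutive {v} ¬mv with complete (x₃ v) (~-sym (~x₃ v))
    ... | inj₁ v≡        = ⊥-elim (outer-lonely ¬mv (subst (_~ x₂ (x₃ v)) (sym v≡) (x₁~x₂ (x₃ v))) (~x₂ (x₃ v)))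
    ... | inj₂ (inj₁ v≡) = ⊥-elim (outer-lonely ¬mv (subst (_~ x₁ (x₃ v)) (sym v≡) (~-sym (x₁~x₂ (x₃ v))))
                                     (~x₁ (x₃ v)))
    ... | inj₂ (inj₂ v≡) = sym v≡

    OnTriangle : V → Set
    OnTriangle x = isMid x ≡ false × isMid (x₁ x) ≡ false

    infix 4 _∈△_

    _∈△_ : V → V → Set
    y ∈△ x = y ∈⟨ x , x₁ x , x₂ x ⟩

    OnTriangle-x₂ : ∀ {x} → OnTriangle x → isMid (x₂ x) ≡ false
    OnTriangle-x₂ (¬mx , ¬m₁) = trans (sym (mates-isMid ¬mx)) ¬m₁

    triangle-x₁ : ∀ {x} → OnTriangle x →
                  (x₁ (x₁ x) ≡ x × x₂ (x₁ x) ≡ x₂ x) ⊎ (x₁ (x₁ x) ≡ x₂ x × x₂ (x₁ x) ≡ x)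
    triangle-x₁ {x} (_ , ¬m₁) with adjacentNeighbours-nonMid ¬m₁ (~-sym (~x₁ x)) (x₁~x₂ x) (~x₂ x) (~-irrefl (~x₂ x))
    ... | inj₁ (p , q) = inj₁ (sym p , sym q)
    ... | inj₂ (p , q) = inj₂ (sym q , sym p)

    triangle-x₂ : ∀ {x} → OnTriangle x →
                  (x₁ (x₂ x) ≡ x × x₂ (x₂ x) ≡ x₁ x) ⊎ (x₁ (x₂ x) ≡ x₁ x × x₂ (x₂ x) ≡ x)
    triangle-x₂ {x} t with adjacentNeighbours-nonMid (OnTriangle-x₂ t) (~-sym (~x₂ x)) (~-sym (x₁~x₂ x)) (~x₁ x)
                             (~-irrefl (~x₁ x))
    ... | inj₁ (p , q) = inj₁ (sym p , sym q)
    ... | inj₂ (p , q) = inj₂ (sym q , sym p)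

    triangle-member : ∀ {x y} → OnTriangle x → y ∈△ x → OnTriangle y × (∀ {z} → z ∈△ x → z ∈△ y)
    triangle-member t first = t , λ z∈ → z∈
    triangle-member {x} t second with triangle-x₁ t
    ... | inj₁ (p , q) = (proj₂ t , trans (cong isMid p) (proj₁ t)) , λ where
      (inj₁ z≡)        → inj₂ (inj₁ (trans z≡ (sym p)))
      (inj₂ (inj₁ z≡)) → inj₁ z≡
      (inj₂ (inj₂ z≡)) → inj₂ (inj₂ (trans z≡ (sym q)))
    ... | inj₂ (p , q) = (proj₂ t , trans (cong isMid p) (OnTriangle-x₂ t)) , λ where
      (inj₁ z≡)        → inj₂ (inj₂ (trans z≡ (sym q)))
      (inj₂ (inj₁ z≡)) → inj₁ z≡
      (inj₂ (inj₂ z≡)) → inj₂ (inj₁ (trans z≡ (sym p)))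
    triangle-member {x} t third with triangle-x₂ t
    ... | inj₁ (p , q) = (OnTriangle-x₂ t , trans (cong isMid p) (proj₁ t)) , λ where
      (inj₁ z≡)        → inj₂ (inj₁ (trans z≡ (sym p)))
      (inj₂ (inj₁ z≡)) → inj₂ (inj₂ (trans z≡ (sym q)))
      (inj₂ (inj₂ z≡)) → inj₁ z≡
    ... | inj₂ (p , q) = (OnTriangle-x₂ t , trans (cong isMid p) (proj₂ t)) , λ where
      (inj₁ z≡)        → inj₂ (inj₂ (trans z≡ (sym q)))
      (inj₂ (inj₁ z≡)) → inj₂ (inj₁ (trans z≡ (sym p)))
      (inj₂ (inj₂ z≡)) → inj₁ z≡

    ∈△-OnTriangle : ∀ {x y} → OnTriangle x → y ∈△ x → OnTriangle y
    ∈△-OnTriangle t y∈ = proj₁ (triangle-member t y∈)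

    ∈△-trans : ∀ {x y z} → OnTriangle x → y ∈△ x → z ∈△ x → z ∈△ y
    ∈△-trans t y∈ z∈ = proj₂ (triangle-member t y∈) z∈

    ∈△-sym : ∀ {x y} → OnTriangle x → y ∈△ x → x ∈△ y
    ∈△-sym t y∈ = ∈△-trans t y∈ first

    outer-∉△ : ∀ {z} → isMid z ≡ false → ¬ x₃ z ∈△ z
    outer-∉△ {z} _ (inj₁ x₃≡)        = ~-irrefl (~x₃ z) (sym x₃≡)
    outer-∉△ {z} _ (inj₂ (inj₁ x₃≡)) = x₁≢x₃ z (sym x₃≡)
    outer-∉△ {z} _ (inj₂ (inj₂ x₃≡)) = x₂≢x₃ z (sym x₃≡)

    Mate : V → V → Set
    Mate y z = z ≡ x₁ y ⊎ z ≡ x₂ y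

    Mate⇒∈△ : ∀ {y z} → Mate y z → z ∈△ y
    Mate⇒∈△ = inj₂

    Mate⇒≢ : ∀ {y z} → Mate y z → y ≢ z
    Mate⇒≢ {y} (inj₁ refl) = ~-irrefl (~x₁ y)
    Mate⇒≢ {y} (inj₂ refl) = ~-irrefl (~x₂ y)

    ∈△⇒Mate : ∀ {y z} → z ∈△ y → y ≢ z → Mate y z
    ∈△⇒Mate (inj₁ z≡) y≢z = ⊥-elim (y≢z (sym z≡))
    ∈△⇒Mate (inj₂ m)  _   = m

    ~⇒Mate : ∀ {x y} → x ~ y → y ≢ x₃ x → Mate x y
    ~⇒Mate {x} x~y y≢ with complete x x~y
    ... | inj₁ y≡        = inj₁ y≡
    ... | inj₂ (inj₁ y≡) = inj₂ y≡
    ... | inj₂ (inj₂ y≡) = ⊥-elim (y≢ y≡)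

    Mate⇒OnTriangle : ∀ {x y} → isMid x ≡ false → isMid y ≡ false → Mate x y → OnTriangle x
    Mate⇒OnTriangle ¬mx ¬my (inj₁ refl) = ¬mx , ¬my
    Mate⇒OnTriangle ¬mx ¬my (inj₂ refl) = ¬mx , trans (mates-isMid ¬mx) ¬my

    IsTip : V → V → Set
    IsTip m t = m ~ t × t ≢ x₁ m

    otherTip : V → V → V
    otherTip m t = if does (t ≟ x₂ m) then x₃ m else x₂ m

    otherTip-spec : ∀ {m t} → IsTip m t →
                    otherTip m t ≢ t × IsTip m (otherTip m t) × (∀ {s} → IsTip m s → s ≢ t → s ≡ otherTip m t)
    otherTip-spec {m} {t} (m~t , t≢) with t ≟ x₂ m
    ... | yes refl = (λ x₃≡ → x₂≢x₃ m (sym x₃≡)) , (~x₃ m , λ x₃≡ → x₁≢x₃ m (sym x₃≡)) , unique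
      where
      unique : ∀ {s} → IsTip m s → s ≢ x₂ m → s ≡ x₃ m
      unique (m~s , s≢) s≢x₂ with complete m m~s
      ... | inj₁ s≡        = ⊥-elim (s≢ s≡)
      ... | inj₂ (inj₁ s≡) = ⊥-elim (s≢x₂ s≡)
      ... | inj₂ (inj₂ s≡) = s≡
    ... | no t≢x₂ with complete m m~t
    ... | inj₁ t≡        = ⊥-elim (t≢ t≡)
    ... | inj₂ (inj₁ t≡) = ⊥-elim (t≢x₂ t≡)
    ... | third = x₂≢x₃ m , (~x₂ m , λ x₂≡ → x₁≢x₂ m (sym x₂≡)) , unique
      where
      unique : ∀ {s} → IsTip m s → s ≢ x₃ m → s ≡ x₂ m
      unique (m~s , s≢) s≢x₃ with complete m m~s
      ... | inj₁ s≡        = ⊥-elim (s≢ s≡)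
      ... | inj₂ (inj₁ s≡) = s≡
      ... | inj₂ (inj₂ s≡) = ⊥-elim (s≢x₃ s≡)

    IsTip-partner : ∀ {m t} → isMid m ≡ true → IsTip m t → IsTip (x₁ m) t
    IsTip-partner mm (m~t , t≢) = partner-~ mm m~t t≢ , λ t≡ → ~-irrefl m~t (sym (trans t≡ (partner-involutive mm)))

    otherTip-partner : ∀ {m t} → isMid m ≡ true → IsTip m t → otherTip (x₁ m) t ≡ otherTip m t
    otherTip-partner mm tip =
      let (o≢t , tip′ , _) = otherTip-spec tip
          (_ , _ , unique) = otherTip-spec (IsTip-partner mm tip)
      in sym (unique (IsTip-partner mm tip′) o≢t)

    -- Free triangles

    private
      ∧-true : ∀ {a b} → a ∧ b ≡ true → a ≡ true × b ≡ true
      ∧-true {true} b≡ = refl , b≡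

      not-true : ∀ {a} → not a ≡ true → a ≡ false
      not-true {false} _ = refl

      ∨₃-intro : ∀ {a b c} → a ≡ true ⊎ b ≡ true ⊎ c ≡ true → a ∨ b ∨ c ≡ true
      ∨₃-intro         (inj₁ refl)        = refl
      ∨₃-intro {a}     (inj₂ (inj₁ refl)) = ∨-zeroʳ a
      ∨₃-intro {a} {b} (inj₂ (inj₂ refl)) = trans (cong (a ∨_) (∨-zeroʳ b)) (∨-zeroʳ a)

      ∨₃-elim : ∀ a b c → a ∨ b ∨ c ≡ true → a ≡ true ⊎ b ≡ true ⊎ c ≡ true
      ∨₃-elim true  _     _    _ = inj₁ refl
      ∨₃-elim false true  _    _ = inj₂ (inj₁ refl)
      ∨₃-elim false false true _ = inj₂ (inj₂ refl)

    isTriangleVertex isTipVertex : V → Bool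
    isTriangleVertex v = not (isMid v) ∧ not (isMid (x₁ v))
    isTipVertex      v = not (isMid v) ∧ isMid (x₁ v)

    isTriangleVertex⇒OnTriangle : ∀ {x} → isTriangleVertex x ≡ true → OnTriangle x
    isTriangleVertex⇒OnTriangle {x} eq with isMid x | isMid (x₁ x)
    ... | false | false = refl , refl

    OnTriangle⇒isTriangleVertex : ∀ {x} → OnTriangle x → isTriangleVertex x ≡ true
    OnTriangle⇒isTriangleVertex (¬mx , ¬m₁) rewrite ¬mx | ¬m₁ = refl

    nonTip⇒OnTriangle : ∀ {y} → isMid y ≡ false → isTipVertex y ≡ false → OnTriangle y
    nonTip⇒OnTriangle {y} ¬my eq rewrite ¬my with isMid (x₁ y)
    ... | false = refl , refl

    triangleOf : V → List V
    triangleOf y = y ∷ x₁ y ∷ x₂ y ∷ []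

    -- A triangle is a candidate when every neighbour outside it lies on a triangle (not in a diamond);
    -- two candidates conflict when an edge joins their triangles.
    candidate : V → Bool
    candidate x = isTriangleVertex x ∧ not (isTipVertex (x₃ x)) ∧ not (isTipVertex (x₃ (x₁ x)))
                                       ∧ not (isTipVertex (x₃ (x₂ x)))

    outerTriangles : V → List V
    outerTriangles x = triangleOf (x₃ x) ++ triangleOf (x₃ (x₁ x)) ++ triangleOf (x₃ (x₂ x))

    outerTriangles⁺ : ∀ {x z w} → z ∈△ x → w ∈△ x₃ z → w ∈ outerTriangles x
    outerTriangles⁺ first  w∈ = ∈-++⁺ˡ (∈⟨⟩⇒∈ w∈)
    outerTriangles⁺ second w∈ = ∈-++⁺ʳ (triangleOf _) (∈-++⁺ˡ (∈⟨⟩⇒∈ w∈))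
    outerTriangles⁺ third  w∈ = ∈-++⁺ʳ (triangleOf _) (∈-++⁺ʳ (triangleOf _) (∈⟨⟩⇒∈ w∈))

    outerTriangles⁻ : ∀ {x w} → w ∈ outerTriangles x → Σ V λ z → z ∈△ x × w ∈△ x₃ z
    outerTriangles⁻ {x} w∈ with ∈-++⁻ (triangleOf (x₃ x)) w∈
    ... | inj₁ w∈₀ = x , first , ∈⇒∈⟨⟩ w∈₀
    ... | inj₂ w∈′ with ∈-++⁻ (triangleOf (x₃ (x₁ x))) w∈′
    ... | inj₁ w∈₁ = x₁ x , second , ∈⇒∈⟨⟩ w∈₁
    ... | inj₂ w∈₂ = x₂ x , third , ∈⇒∈⟨⟩ w∈₂

    candidate⇒OnTriangle : ∀ {x} → candidate x ≡ true → OnTriangle x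
    candidate⇒OnTriangle c = isTriangleVertex⇒OnTriangle (proj₁ (∧-true c))

    candidate⇒outer-nonTip : ∀ {x z} → candidate x ≡ true → z ∈△ x → isTipVertex (x₃ z) ≡ false
    candidate⇒outer-nonTip {x} c z∈ with ∧-true {isTriangleVertex x} c
    ... | _ , c₀ with ∧-true {not (isTipVertex (x₃ x))} c₀
    ... | t₀ , c₁ with ∧-true {not (isTipVertex (x₃ (x₁ x)))} c₁
    ... | t₁ , t₂ with z∈
    ... | first  = not-true t₀
    ... | second = not-true t₁
    ... | third  = not-true t₂

    nonCandidate⇒outerTip : ∀ {x} → OnTriangle x → candidate x ≡ false →
                            Σ V λ z → z ∈△ x × isTipVertex (x₃ z) ≡ true
    nonCandidate⇒outerTip {x} t nc rewrite OnTriangle⇒isTriangleVertex t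
      with isTipVertex (x₃ x) in t₀ | isTipVertex (x₃ (x₁ x)) in t₁ | isTipVertex (x₃ (x₂ x)) in t₂
    ... | true  | _     | _     = x , first , t₀
    ... | false | true  | _     = x₁ x , second , t₁
    ... | false | false | true  = x₂ x , third , t₂
    ... | false | false | false with nc
    ... | ()

    open MaximalIndependentSet outerTriangles candidate
      using (selected; selected⇒candidate; selected-independent; selected-maximal)

    isFree : V → Bool
    isFree x = selected x ∨ selected (x₁ x) ∨ selected (x₂ x)

    isFree-witness : ∀ {x} → isFree x ≡ true → Σ V λ z → z ∈△ x × selected z ≡ true
    isFree-witness {x} free with ∨₃-elim (selected x) (selected (x₁ x)) (selected (x₂ x)) free
    ... | inj₁ s        = x , first , s
    ... | inj₂ (inj₁ s) = x₁ x , second , s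
    ... | inj₂ (inj₂ s) = x₂ x , third , s

    selected⇒isFree : ∀ {x z} → z ∈△ x → selected z ≡ true → isFree x ≡ true
    selected⇒isFree {x} z∈ s = ∨₃-intro {selected x} {selected (x₁ x)} {selected (x₂ x)} (at z∈ s)
      where
      at : ∀ {z} → z ∈△ x → selected z ≡ true →
           selected x ≡ true ⊎ selected (x₁ x) ≡ true ⊎ selected (x₂ x) ≡ true
      at first  s = inj₁ s
      at second s = inj₂ (inj₁ s)
      at third  s = inj₂ (inj₂ s)

    isFree-∈△ : ∀ {x y} → OnTriangle x → y ∈△ x → isFree y ≡ isFree x
    isFree-∈△ {x} {y} t y∈ with isFree x in fx | isFree y in fy
    ... | true  | true  = refl
    ... | false | false = refl
    ... | false | true  = let (z , z∈ , s) = isFree-witness fy in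
      case trans (sym fx) (selected⇒isFree (∈△-trans (∈△-OnTriangle t y∈) (∈△-sym t y∈) z∈) s) of λ ()
    ... | true  | false = let (z , z∈ , s) = isFree-witness fx in
      case trans (sym fy) (selected⇒isFree (∈△-trans t y∈ z∈) s) of λ ()

    onNonFreeTriangle : V → Bool
    onNonFreeTriangle y = isTriangleVertex y ∧ not (isFree y)

    tip⇒¬onNonFreeTriangle : ∀ {y} → isTipVertex y ≡ true → onNonFreeTriangle y ≡ false
    tip⇒¬onNonFreeTriangle {y} tip with isMid y | isMid (x₁ y)
    ... | true  | _    = refl
    ... | false | true = refl

    free⇒¬onNonFreeTriangle : ∀ {y} → isFree y ≡ true → onNonFreeTriangle y ≡ false
    free⇒¬onNonFreeTriangle {y} free rewrite free = ∧-zeroʳ (isTriangleVertex y)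

    nonFree-exit : ∀ {x} → OnTriangle x → isFree x ≡ false → Σ V λ z → z ∈△ x × onNonFreeTriangle (x₃ z) ≡ false
    nonFree-exit {x} t nf with candidate x in cx
    ... | false = let (z , z∈ , tip) = nonCandidate⇒outerTip t cx in z , z∈ , tip⇒¬onNonFreeTriangle tip
    ... | true with selected x in sx
    ... | true  = case nf of λ ()
    ... | false = let (y , y∈ , sy) = selected-maximal cx sx
                      (z , z∈ , y∈′) = outerTriangles⁻ y∈
                  in z , z∈ , free⇒¬onNonFreeTriangle (selected⇒isFree y∈′ sy)

    outer-of-free-OnTriangle : ∀ {x z} → OnTriangle x → isFree x ≡ true → z ∈△ x → OnTriangle (x₃ z)
    outer-of-free-OnTriangle t free z∈ =
      let (y , y∈ , sy) = isFree-witness free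
          z∈y = ∈△-trans t y∈ z∈
      in nonTip⇒OnTriangle (outer-nonMid (proj₁ (∈△-OnTriangle t z∈)))
           (candidate⇒outer-nonTip (selected⇒candidate sy) z∈y)

    free-unlinked : ∀ {x z} → OnTriangle x → isFree x ≡ true → z ∈△ x → isFree (x₃ z) ≡ true → ⊥
    free-unlinked {x} {z} t free z∈ free′ =
      let (y₁ , y₁∈ , s₁) = isFree-witness free
          (y₂ , y₂∈ , s₂) = isFree-witness free′
          t′ = outer-of-free-OnTriangle t free z∈
          ¬mz = proj₁ (∈△-OnTriangle t z∈)
          z∈y₁ = ∈△-trans t y₁∈ z∈
          y₁∈z = ∈△-trans t z∈ y₁∈
      in selected-independent
           (outerTriangles⁺ z∈y₁ y₂∈)
           (outerTriangles⁺ (∈△-sym t′ y₂∈) (subst (y₁ ∈△_) (sym (outer-involutive ¬mz)) y₁∈z))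
           (λ y₁≡y₂ → outer-∉△ ¬mz (∈△-trans (∈△-OnTriangle t y₁∈) z∈y₁
                                      (subst (x₃ z ∈△_) (sym y₁≡y₂) (∈△-sym t′ y₂∈))))
           s₁ s₂

    onNonFreeTriangle⇒OnTriangle : ∀ {y} → onNonFreeTriangle y ≡ true → OnTriangle y
    onNonFreeTriangle⇒OnTriangle {y} k = isTriangleVertex⇒OnTriangle (proj₁ (∧-true {isTriangleVertex y} k))

    onNonFreeTriangle⇒¬isFree : ∀ {y} → onNonFreeTriangle y ≡ true → isFree y ≡ false
    onNonFreeTriangle⇒¬isFree {y} k = not-true (proj₂ (∧-true {isTriangleVertex y} k))

    onNonFreeTriangle-intro : ∀ {y} → OnTriangle y → isFree y ≡ false → onNonFreeTriangle y ≡ true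
    onNonFreeTriangle-intro t nf rewrite OnTriangle⇒isTriangleVertex t | nf = refl

    onNonFreeTriangle-∈△ : ∀ {x y} → onNonFreeTriangle x ≡ true → y ∈△ x → onNonFreeTriangle y ≡ true
    onNonFreeTriangle-∈△ k y∈ =
      let t = onNonFreeTriangle⇒OnTriangle k in
      onNonFreeTriangle-intro (∈△-OnTriangle t y∈) (trans (isFree-∈△ t y∈) (onNonFreeTriangle⇒¬isFree k))

    onNonFreeTriangle-outer² : ∀ {y} → onNonFreeTriangle y ≡ true → onNonFreeTriangle (x₃ (x₃ y)) ≡ true
    onNonFreeTriangle-outer² k =
      subst (λ u → onNonFreeTriangle u ≡ true) (sym (outer-involutive (proj₁ (onNonFreeTriangle⇒OnTriangle k)))) k

    -- Link colours

    -- A link x – x₃ x is named by its smaller endpoint.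
    linkOwner : V → V
    linkOwner x = if x ≺ x₃ x then x else x₃ x

    linkOwner-cases : ∀ x → linkOwner x ≡ x ⊎ linkOwner x ≡ x₃ x
    linkOwner-cases x with x ≺ x₃ x
    ... | true  = inj₁ refl
    ... | false = inj₂ refl

    linkOwner-outer : ∀ {x} → isMid x ≡ false → linkOwner (x₃ x) ≡ linkOwner x
    linkOwner-outer {x} ¬mx rewrite outer-involutive ¬mx | ≺-flip (~-irrefl (~x₃ x)) with x ≺ x₃ x
    ... | true  = refl
    ... | false = refl

    linkOwner-mates-≢ : ∀ {y z} → OnTriangle y → Mate y z → linkOwner y ≢ linkOwner z
    linkOwner-mates-≢ {y} {z} t m eq with linkOwner-cases y | linkOwner-cases z
    ... | inj₁ oy | inj₁ oz = Mate⇒≢ m (trans (sym oy) (trans eq oz))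
    ... | inj₁ oy | inj₂ oz = outer-∉△ (proj₁ (∈△-OnTriangle t (Mate⇒∈△ m)))
                                (subst (_∈△ z) (trans (sym oy) (trans eq oz)) (∈△-sym t (Mate⇒∈△ m)))
    ... | inj₂ oy | inj₁ oz = outer-∉△ (proj₁ t) (subst (_∈△ y) (sym (trans (sym oy) (trans eq oz))) (Mate⇒∈△ m))
    ... | inj₂ oy | inj₂ oz = Mate⇒≢ m (trans (sym (outer-involutive (proj₁ t)))
                                (trans (cong x₃ (trans (sym oy) (trans eq oz)))
                                  (outer-involutive (proj₁ (∈△-OnTriangle t (Mate⇒∈△ m))))))

    innerLinkAt : V → List V
    innerLinkAt z = if onNonFreeTriangle (x₃ z) then linkOwner z ∷ [] else []

    innerLinksAtMates : V → List V
    innerLinksAtMates e = if onNonFreeTriangle e then innerLinkAt (x₁ e) ++ innerLinkAt (x₂ e) else []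

    -- Links joining two non-free triangles, named by their owners, conflict when they share a triangle.
    linkConflicts : V → List V
    linkConflicts u = innerLinksAtMates u ++ innerLinksAtMates (x₃ u)

    open ThreeColouring linkConflicts renaming (colour to innerLinkColour; colour-proper to innerLinkColour-proper)

    innerLinksAtMates-∋ : ∀ {e z} → onNonFreeTriangle e ≡ true → Mate e z → onNonFreeTriangle (x₃ z) ≡ true →
                          linkOwner z ∈ innerLinksAtMates e
    innerLinksAtMates-∋ {e} k (inj₁ refl) kz rewrite k | kz = here refl
    innerLinksAtMates-∋ {e} k (inj₂ refl) kz rewrite k | kz = ∈-++⁺ʳ (innerLinkAt (x₁ e)) (here refl)

    linkConflicts-∋ : ∀ {y z} → onNonFreeTriangle y ≡ true → onNonFreeTriangle (x₃ y) ≡ true → Mate y z →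
                      onNonFreeTriangle (x₃ z) ≡ true → linkOwner z ∈ linkConflicts (linkOwner y)
    linkConflicts-∋ {y} k ko m kz with linkOwner-cases y
    ... | inj₁ oy rewrite oy = ∈-++⁺ˡ (innerLinksAtMates-∋ k m kz)
    ... | inj₂ oy rewrite oy | outer-involutive (proj₁ (onNonFreeTriangle⇒OnTriangle k)) =
      ∈-++⁺ʳ (innerLinksAtMates (x₃ y)) (innerLinksAtMates-∋ k m kz)

    innerLinksAtMates-length : ∀ {e} → onNonFreeTriangle e ≡ true → onNonFreeTriangle (x₃ e) ≡ true →
                               length (innerLinksAtMates e) ≤ 1
    innerLinksAtMates-length {e} k ko
      with nonFree-exit (onNonFreeTriangle⇒OnTriangle k) (onNonFreeTriangle⇒¬isFree k)
    ... | _ , inj₁ refl , kz = case trans (sym ko) kz of λ ()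
    ... | _ , second , kz rewrite k | kz with onNonFreeTriangle (x₃ (x₂ e))
    ... | true  = s≤s z≤n
    ... | false = z≤n
    innerLinksAtMates-length {e} k ko | _ , third , kz rewrite k | kz with onNonFreeTriangle (x₃ (x₁ e))
    ... | true  = s≤s z≤n
    ... | false = z≤n

    linkConflicts-length : ∀ {y} → onNonFreeTriangle y ≡ true → onNonFreeTriangle (x₃ y) ≡ true →
                           length (linkConflicts (linkOwner y)) ≤ 2
    linkConflicts-length {y} k ko with linkOwner-cases y
    ... | inj₁ oy rewrite oy | length-++ (innerLinksAtMates y) {innerLinksAtMates (x₃ y)} =
      +-mono-≤ (innerLinksAtMates-length k ko) (innerLinksAtMates-length ko (onNonFreeTriangle-outer² k))
    ... | inj₂ oy rewrite oy | outer-involutive (proj₁ (onNonFreeTriangle⇒OnTriangle k))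
                         | length-++ (innerLinksAtMates (x₃ y)) {innerLinksAtMates y} =
      +-mono-≤ (innerLinksAtMates-length ko (onNonFreeTriangle-outer² k)) (innerLinksAtMates-length k ko)

    innerLinkColour-mates : ∀ {y z} → onNonFreeTriangle y ≡ true → onNonFreeTriangle (x₃ y) ≡ true → Mate y z →
                            onNonFreeTriangle (x₃ z) ≡ true → innerLinkColour (linkOwner y) ≢ innerLinkColour (linkOwner z)
    innerLinkColour-mates {y} {z} k ko m kz =
      let t = onNonFreeTriangle⇒OnTriangle k
          kz′ = onNonFreeTriangle-∈△ k (Mate⇒∈△ m)
          m′ = ∈△⇒Mate (∈△-sym t (Mate⇒∈△ m)) (≢-sym (Mate⇒≢ m))
      in innerLinkColour-proper (linkConflicts-∋ k ko m kz) (linkConflicts-∋ kz′ kz m′ ko) (linkOwner-mates-≢ t m)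
           (linkConflicts-length k ko) (linkConflicts-length kz′ kz)

    prescribed : V → Maybe (Fin 3)
    prescribed z = if onNonFreeTriangle (x₃ z) then just (innerLinkColour (linkOwner z)) else nothing

    triangleLinkColour : V → Fin 3
    triangleLinkColour x = completedLinkColour (prescribed x) (prescribed (x₁ x)) (prescribed (x₂ x)) (x ≺ x₁ x) (x ≺ x₂ x)

    -- 0F is an arbitrary colour for a link with no non-free triangle at either end.
    linkColour : V → Fin 3
    linkColour x = if onNonFreeTriangle x then triangleLinkColour x
                   else if onNonFreeTriangle (x₃ x) then triangleLinkColour (x₃ x) else 0F

    triangleLinkColour-inner : ∀ {x} → onNonFreeTriangle (x₃ x) ≡ true →
                               triangleLinkColour x ≡ innerLinkColour (linkOwner x)
    triangleLinkColour-inner {x} ko rewrite ko = refl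

    linkColour-onNonFree : ∀ {x} → onNonFreeTriangle x ≡ true → linkColour x ≡ triangleLinkColour x
    linkColour-onNonFree {x} k rewrite k = refl

    linkColour-outer : ∀ {x} → isMid x ≡ false → linkColour (x₃ x) ≡ linkColour x
    linkColour-outer {x} ¬mx =
      trans (cong (λ u → if onNonFreeTriangle (x₃ x) then triangleLinkColour (x₃ x)
                         else if onNonFreeTriangle u then triangleLinkColour u else 0F) (outer-involutive ¬mx))
            (if-swap (onNonFreeTriangle x) (onNonFreeTriangle (x₃ x)) λ k ko →
               trans (triangleLinkColour-inner ko)
                 (trans (cong innerLinkColour (sym (linkOwner-outer ¬mx)))
                   (sym (triangleLinkColour-inner (trans (cong onNonFreeTriangle (outer-involutive ¬mx)) k)))))
      where
      if-swap : ∀ a b {c d : Fin 3} → (a ≡ true → b ≡ true → c ≡ d) →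
                (if b then d else if a then c else 0F) ≡ (if a then c else if b then d else 0F)
      if-swap true  true  c≡d = sym (c≡d refl refl)
      if-swap true  false _   = refl
      if-swap false true  _   = refl
      if-swap false false _   = refl

    prescribed-compatible : ∀ {y z} → onNonFreeTriangle y ≡ true → Mate y z → Compatible (prescribed y) (prescribed z)
    prescribed-compatible {y} {z} k m with onNonFreeTriangle (x₃ y) in ky | onNonFreeTriangle (x₃ z) in kz
    ... | false | _     = inj₁ refl
    ... | true  | false = inj₂ λ ()
    ... | true  | true  = inj₂ λ eq → innerLinkColour-mates k ky m kz (just-injective eq)

    triangleLinkColour-mates : ∀ {p a b} → (x₁ p ≡ a × x₂ p ≡ b) ⊎ (x₁ p ≡ b × x₂ p ≡ a) →
      triangleLinkColour p ≡ completedLinkColour (prescribed p) (prescribed a) (prescribed b) (p ≺ a) (p ≺ b)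
    triangleLinkColour-mates (inj₁ (refl , refl)) = refl
    triangleLinkColour-mates {p} (inj₂ (refl , refl)) =
      completedLinkColour-swap (prescribed p) (prescribed (x₁ p)) (prescribed (x₂ p)) (p ≺ x₁ p) (p ≺ x₂ p)

    nonFree-linkColours-distinct : ∀ {x} → OnTriangle x → isFree x ≡ false →
      linkColour x ≢ linkColour (x₁ x) × linkColour x ≢ linkColour (x₂ x) × linkColour (x₁ x) ≢ linkColour (x₂ x)
    nonFree-linkColours-distinct {x} t nf =
      let kx = onNonFreeTriangle-intro t nf
          kp = onNonFreeTriangle-∈△ kx second
          kq = onNonFreeTriangle-∈△ kx third
          x≢p = ~-irrefl (~x₁ x) ; x≢q = ~-irrefl (~x₂ x) ; p≢q = x₁≢x₂ x
          cx : linkColour x ≡ completedLinkColour (prescribed x) (prescribed p) (prescribed q) (x ≺ p) (x ≺ q)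
          cx = linkColour-onNonFree kx
          cp : linkColour p ≡ completedLinkColour (prescribed p) (prescribed x) (prescribed q) (not (x ≺ p)) (p ≺ q)
          cp = trans (linkColour-onNonFree kp) (trans (triangleLinkColour-mates (triangle-x₁ t))
                 (cong (λ b → completedLinkColour (prescribed p) (prescribed x) (prescribed q) b (p ≺ q)) (≺-flip x≢p)))
          cq : linkColour q ≡ completedLinkColour (prescribed q) (prescribed x) (prescribed p) (not (x ≺ q)) (not (p ≺ q))
          cq = trans (linkColour-onNonFree kq) (trans (triangleLinkColour-mates (triangle-x₂ t))
                 (cong₂ (completedLinkColour (prescribed q) (prescribed x) (prescribed p)) (≺-flip x≢q) (≺-flip p≢q)))
          (d₁ , d₂ , d₃) = completedLinkColour-proper (prescribed x) (prescribed p) (prescribed q) (x ≺ p) (x ≺ q) (p ≺ q)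
                             (≺-consistent x≢p x≢q p≢q) (some-unprescribed (nonFree-exit t nf))
                             (prescribed-compatible kx (inj₁ refl)) (prescribed-compatible kx (inj₂ refl))
                             (prescribed-compatible kp (∈△⇒Mate (∈△-trans t second third) p≢q))
      in (λ e → d₁ (trans (sym cx) (trans e cp))) , (λ e → d₂ (trans (sym cx) (trans e cq))) ,
         (λ e → d₃ (trans (sym cp) (trans e cq)))
      where
      p = x₁ x
      q = x₂ x
      some-unprescribed : (Σ V λ z → z ∈△ x × onNonFreeTriangle (x₃ z) ≡ false) →
                          prescribed x ≡ nothing ⊎ prescribed p ≡ nothing ⊎ prescribed q ≡ nothing
      some-unprescribed (_ , first  , k) rewrite k = inj₁ refl
      some-unprescribed (_ , second , k) rewrite k = inj₂ (inj₁ refl)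
      some-unprescribed (_ , third  , k) rewrite k = inj₂ (inj₂ refl)

    thirdVertex : V → V → V
    thirdVertex u v = if does (v ≟ x₁ u) then x₂ u else x₁ u

    thirdVertex-x₁ : ∀ {u} → thirdVertex u (x₁ u) ≡ x₂ u
    thirdVertex-x₁ {u} = cong (if_then x₂ u else x₁ u) (dec-true (x₁ u ≟ x₁ u) refl)

    thirdVertex-x₂ : ∀ {u} → thirdVertex u (x₂ u) ≡ x₁ u
    thirdVertex-x₂ {u} = cong (if_then x₂ u else x₁ u) (dec-false (x₂ u ≟ x₁ u) (≢-sym (x₁≢x₂ u)))

    triangleEdgeColourBy : Bool → V → V → V → Fin 4
    triangleEdgeColourBy true  u v w =
      freeTriangleEdgeColour (linkColour u) (linkColour v) (linkColour w) (u ≺ w) (v ≺ w)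
    triangleEdgeColourBy false u v w = inject₁ (linkColour w)

    triangleEdgeColour : V → V → Fin 4
    triangleEdgeColour u v = triangleEdgeColourBy (isFree u) u v (thirdVertex u v)

    nonMidEdgeColour : V → V → Fin 4
    nonMidEdgeColour u v = if does (v ≟ x₃ u) then inject₁ (linkColour u) else triangleEdgeColour u v

    tipEdgeColour : V → V → Fin 4
    tipEdgeColour m t = inject₁ (diamondEdgeColour (linkColour t) (linkColour o) (t ≺ o xor m ≺ x₁ m))
      where o = otherTip m t

    colourBy : Bool → Bool → V → V → Fin 4
    colourBy true  true  u v = 3F
    colourBy true  false u v = tipEdgeColour u v
    colourBy false true  u v = tipEdgeColour v u
    colourBy false false u v = nonMidEdgeColour u v

    colour : V → V → Fin 4
    colour u v = colourBy (isMid u) (isMid v) u v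

    colour-≡ : ∀ {u v a b} → isMid u ≡ a → isMid v ≡ b → colour u v ≡ colourBy a b u v
    colour-≡ refl refl = refl

    nonMidEdgeColour-outer : ∀ {u} → nonMidEdgeColour u (x₃ u) ≡ inject₁ (linkColour u)
    nonMidEdgeColour-outer {u} =
      cong (if_then inject₁ (linkColour u) else triangleEdgeColour u (x₃ u)) (dec-true (x₃ u ≟ x₃ u) refl)

    nonMidEdgeColour-mate : ∀ {u v} → v ≢ x₃ u → nonMidEdgeColour u v ≡ triangleEdgeColour u v
    nonMidEdgeColour-mate {u} {v} v≢ =
      cong (if_then inject₁ (linkColour u) else triangleEdgeColour u v) (dec-false (v ≟ x₃ u) v≢)

    data Kind (x : V) : Set where
      mid             : isMid x ≡ true → Kind x
      tip             : isMid x ≡ false → isMid (x₁ x) ≡ true → Kind x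
      freeTriangle    : OnTriangle x → isFree x ≡ true → Kind x
      nonFreeTriangle : OnTriangle x → isFree x ≡ false → Kind x

    kind : ∀ x → Kind x
    kind x with isMid x in mx | isMid (x₁ x) in m₁ | isFree x in fx
    ... | true  | _     | _     = mid mx
    ... | false | true  | _     = tip mx m₁
    ... | false | false | true  = freeTriangle (mx , m₁) fx
    ... | false | false | false = nonFreeTriangle (mx , m₁) fx

    triangleEdgeColour-by : ∀ {u v b} → isFree u ≡ b → triangleEdgeColour u v ≡ triangleEdgeColourBy b u v (thirdVertex u v)
    triangleEdgeColour-by {u} {v} = cong (λ b → triangleEdgeColourBy b u v (thirdVertex u v))

    ProperAt : V → Set
    ProperAt x = colour x (x₁ x) ≢ colour x (x₂ x) × colour x (x₁ x) ≢ colour x (x₃ x)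
               × colour x (x₂ x) ≢ colour x (x₃ x)

    ProperAt⇒proper : ∀ {x y z} → ProperAt x → x ~ y → x ~ z → y ≢ z → colour x y ≢ colour x z
    ProperAt⇒proper {x} {y} {z} (c₁₂ , c₁₃ , c₂₃) x~y x~z y≢z with complete x x~y | complete x x~z
    ... | first  | first  = ⊥-elim (y≢z refl)
    ... | first  | second = c₁₂
    ... | first  | third  = c₁₃
    ... | second | first  = c₁₂ ∘ sym
    ... | second | second = ⊥-elim (y≢z refl)
    ... | second | third  = c₂₃
    ... | third  | first  = c₁₃ ∘ sym
    ... | third  | second = c₂₃ ∘ sym
    ... | third  | third  = ⊥-elim (y≢z refl)

    otherTip-x₂ : ∀ {m} → otherTip m (x₂ m) ≡ x₃ m
    otherTip-x₂ {m} = cong (if_then x₃ m else x₂ m) (dec-true (x₂ m ≟ x₂ m) refl)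

    otherTip-x₃ : ∀ {m} → otherTip m (x₃ m) ≡ x₂ m
    otherTip-x₃ {m} = cong (if_then x₃ m else x₂ m) (dec-false (x₃ m ≟ x₂ m) (≢-sym (x₂≢x₃ m)))

    private
      3F≢inject₁ : ∀ {c : Fin 3} → 3F ≢ inject₁ c
      3F≢inject₁ = fromℕ≢inject₁

      inject₁-≢ : ∀ {c d : Fin 3} → c ≢ d → inject₁ c ≢ inject₁ {3} d
      inject₁-≢ c≢d = c≢d ∘ inject₁-injective

    tipEdgeColour-≡ : ∀ {m t o m′ b} → otherTip m t ≡ o → x₁ m ≡ m′ → t ≺ o xor m ≺ m′ ≡ b →
                      tipEdgeColour m t ≡ inject₁ (diamondEdgeColour (linkColour t) (linkColour o) b)
    tipEdgeColour-≡ refl refl refl = refl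

    ProperAt-mid : ∀ {x} → isMid x ≡ true → ProperAt x
    ProperAt-mid {x} mx =
      let s = x ≺ x₁ x
          b = x₂ x ≺ x₃ x xor s
          c₁ : colour x (x₁ x) ≡ 3F
          c₁ = colour-≡ mx (partner-isMid mx)
          c₂ : colour x (x₂ x) ≡ inject₁ (diamondEdgeColour (linkColour (x₂ x)) (linkColour (x₃ x)) b)
          c₂ = trans (colour-≡ mx (tip-nonMid mx (~x₂ x) (≢-sym (x₁≢x₂ x)))) (tipEdgeColour-≡ otherTip-x₂ refl refl)
          c₃ : colour x (x₃ x) ≡ inject₁ (diamondEdgeColour (linkColour (x₃ x)) (linkColour (x₂ x)) (not b))
          c₃ = trans (colour-≡ mx (tip-nonMid mx (~x₃ x) (≢-sym (x₁≢x₃ x)))) (tipEdgeColour-≡ otherTip-x₃ refl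
                 (trans (cong (_xor s) (≺-flip (x₂≢x₃ x))) (sym (not-distribˡ-xor (x₂ x ≺ x₃ x) s))))
          (other-tip , _ , _) = diamondEdgeColour-proper (linkColour (x₂ x)) (linkColour (x₃ x)) b
      in (λ e → 3F≢inject₁ (trans (sym c₁) (trans e c₂))) , (λ e → 3F≢inject₁ (trans (sym c₁) (trans e c₃))) ,
         (λ e → inject₁-≢ other-tip (trans (sym c₂) (trans e c₃)))

    ProperAt-tip : ∀ {x} → isMid x ≡ false → isMid (x₁ x) ≡ true → ProperAt x
    ProperAt-tip {x} ¬mx m₁ =
      let m₂ = trans (sym (mates-isMid ¬mx)) m₁
          tip : IsTip (x₁ x) x
          tip = ~-sym (~x₁ x) , λ x≡ → ~-irrefl (~x₂ x) (trans x≡ (tip-partner₁ ¬mx m₁))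
          o = otherTip (x₁ x) x
          s = x₁ x ≺ x₂ x
          b = x ≺ o xor s
          o-shared : otherTip (x₂ x) x ≡ o
          o-shared = trans (cong (λ m → otherTip m x) (sym (tip-partner₁ ¬mx m₁))) (otherTip-partner m₁ tip)
          c₁ : colour x (x₁ x) ≡ inject₁ (diamondEdgeColour (linkColour x) (linkColour o) b)
          c₁ = trans (colour-≡ ¬mx m₁) (tipEdgeColour-≡ refl (tip-partner₁ ¬mx m₁) refl)
          c₂ : colour x (x₂ x) ≡ inject₁ (diamondEdgeColour (linkColour x) (linkColour o) (not b))
          c₂ = trans (colour-≡ ¬mx m₂) (tipEdgeColour-≡ o-shared (tip-partner₂ ¬mx m₂)
                 (trans (cong (x ≺ o xor_) (≺-flip (x₁≢x₂ x))) (sym (not-distribʳ-xor (x ≺ o) s))))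
          c₃ : colour x (x₃ x) ≡ inject₁ (linkColour x)
          c₃ = trans (colour-≡ ¬mx (outer-nonMid ¬mx)) nonMidEdgeColour-outer
          (_ , other-mid , ≢link) = diamondEdgeColour-proper (linkColour x) (linkColour o) b
          (_ , _ , ≢link′) = diamondEdgeColour-proper (linkColour x) (linkColour o) (not b)
      in (λ e → inject₁-≢ other-mid (trans (sym c₁) (trans e c₂))) ,
         (λ e → inject₁-≢ ≢link (trans (sym c₁) (trans e c₃))) ,
         (λ e → inject₁-≢ ≢link′ (trans (sym c₂) (trans e c₃)))

    ProperAt-nonFree : ∀ {x} → OnTriangle x → isFree x ≡ false → ProperAt x
    ProperAt-nonFree {x} t nf =
      let (d₁₂ , d₁₃ , d₂₃) = nonFree-linkColours-distinct t nf
          c₁ : colour x (x₁ x) ≡ inject₁ (linkColour (x₂ x))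
          c₁ = trans (colour-≡ (proj₁ t) (proj₂ t)) (trans (nonMidEdgeColour-mate (x₁≢x₃ x))
                 (trans (triangleEdgeColour-by nf) (cong (inject₁ ∘ linkColour) thirdVertex-x₁)))
          c₂ : colour x (x₂ x) ≡ inject₁ (linkColour (x₁ x))
          c₂ = trans (colour-≡ (proj₁ t) (OnTriangle-x₂ t)) (trans (nonMidEdgeColour-mate (x₂≢x₃ x))
                 (trans (triangleEdgeColour-by nf) (cong (inject₁ ∘ linkColour) thirdVertex-x₂)))
          c₃ : colour x (x₃ x) ≡ inject₁ (linkColour x)
          c₃ = trans (colour-≡ (proj₁ t) (outer-nonMid (proj₁ t))) nonMidEdgeColour-outer
      in (λ e → inject₁-≢ (d₂₃ ∘ sym) (trans (sym c₁) (trans e c₂))) ,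
         (λ e → inject₁-≢ (d₁₃ ∘ sym) (trans (sym c₁) (trans e c₃))) ,
         (λ e → inject₁-≢ (d₁₂ ∘ sym) (trans (sym c₂) (trans e c₃)))

    ProperAt-free : ∀ {x} → OnTriangle x → isFree x ≡ true → ProperAt x
    ProperAt-free {x} t free =
      let p = x₁ x ; q = x₂ x
          c₁ : colour x p ≡ freeTriangleEdgeColour (linkColour x) (linkColour p) (linkColour q) (x ≺ q) (p ≺ q)
          c₁ = trans (colour-≡ (proj₁ t) (proj₂ t)) (trans (nonMidEdgeColour-mate (x₁≢x₃ x))
                 (trans (triangleEdgeColour-by free)
                   (cong (λ w → freeTriangleEdgeColour (linkColour x) (linkColour p) (linkColour w) (x ≺ w) (p ≺ w))
                     thirdVertex-x₁)))
          c₂ : colour x q ≡ freeTriangleEdgeColour (linkColour x) (linkColour q) (linkColour p) (x ≺ p) (not (p ≺ q))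
          c₂ = trans (colour-≡ (proj₁ t) (OnTriangle-x₂ t)) (trans (nonMidEdgeColour-mate (x₂≢x₃ x))
                 (trans (triangleEdgeColour-by free)
                   (trans (cong (λ w → freeTriangleEdgeColour (linkColour x) (linkColour q) (linkColour w) (x ≺ w) (q ≺ w))
                            thirdVertex-x₂)
                     (cong (freeTriangleEdgeColour (linkColour x) (linkColour q) (linkColour p) (x ≺ p))
                       (≺-flip (x₁≢x₂ x))))))
          c₃ : colour x (x₃ x) ≡ inject₁ (linkColour x)
          c₃ = trans (colour-≡ (proj₁ t) (outer-nonMid (proj₁ t))) nonMidEdgeColour-outer
          (d₁₂ , d₁₃ , d₂₃) = freeTriangleEdgeColour-proper (linkColour x) (linkColour p) (linkColour q)
                                (x ≺ p) (x ≺ q) (p ≺ q) (≺-consistent (~-irrefl (~x₁ x)) (~-irrefl (~x₂ x)) (x₁≢x₂ x))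
      in (λ e → d₁₂ (trans (sym c₁) (trans e c₂))) , (λ e → d₁₃ (trans (sym c₁) (trans e c₃))) ,
         (λ e → d₂₃ (trans (sym c₂) (trans e c₃)))

    ProperAt-all : ∀ x → ProperAt x
    ProperAt-all x with kind x
    ... | mid mx                = ProperAt-mid mx
    ... | tip ¬mx m₁            = ProperAt-tip ¬mx m₁
    ... | freeTriangle t free   = ProperAt-free t free
    ... | nonFreeTriangle t nf  = ProperAt-nonFree t nf

    thirdVertex-mates : ∀ {p a b} → (x₁ p ≡ a × x₂ p ≡ b) ⊎ (x₁ p ≡ b × x₂ p ≡ a) → thirdVertex p a ≡ b
    thirdVertex-mates (inj₁ (refl , refl)) = thirdVertex-x₁
    thirdVertex-mates (inj₂ (refl , refl)) = thirdVertex-x₂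

    thirdVertex-sym : ∀ {x y} → OnTriangle x → Mate x y → thirdVertex y x ≡ thirdVertex x y
    thirdVertex-sym t (inj₁ refl) = trans (thirdVertex-mates (triangle-x₁ t)) (sym thirdVertex-x₁)
    thirdVertex-sym t (inj₂ refl) = trans (thirdVertex-mates (triangle-x₂ t)) (sym thirdVertex-x₂)

    triangleEdgeColourBy-sym : ∀ b u v w → triangleEdgeColourBy b v u w ≡ triangleEdgeColourBy b u v w
    triangleEdgeColourBy-sym true  u v w =
      freeTriangleEdgeColour-sym (linkColour v) (linkColour u) (linkColour w) (v ≺ w) (u ≺ w)
    triangleEdgeColourBy-sym false u v w = refl

    triangleEdgeColour-sym : ∀ {x y} → OnTriangle x → Mate x y → triangleEdgeColour y x ≡ triangleEdgeColour x y
    triangleEdgeColour-sym {x} {y} t m = begin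
      triangleEdgeColour y x
        ≡⟨ triangleEdgeColour-by (isFree-∈△ t (Mate⇒∈△ m)) ⟩
      triangleEdgeColourBy (isFree x) y x (thirdVertex y x)
        ≡⟨ cong (triangleEdgeColourBy (isFree x) y x) (thirdVertex-sym t m) ⟩
      triangleEdgeColourBy (isFree x) y x (thirdVertex x y)
        ≡⟨ triangleEdgeColourBy-sym (isFree x) x y (thirdVertex x y) ⟩
      triangleEdgeColour x y
        ∎
      where open ≡-Reasoning

    nonMidEdgeColour-sym : ∀ {x y} → isMid x ≡ false → isMid y ≡ false → x ~ y → nonMidEdgeColour x y ≡ nonMidEdgeColour y x
    nonMidEdgeColour-sym {x} {y} ¬mx ¬my x~y = by-cases (y ≟ x₃ x)
      where
      open ≡-Reasoning
      by-cases : Dec (y ≡ x₃ x) → nonMidEdgeColour x y ≡ nonMidEdgeColour y x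
      by-cases (yes y≡) = begin
        nonMidEdgeColour x y                  ≡⟨ cong (nonMidEdgeColour x) y≡ ⟩
        nonMidEdgeColour x (x₃ x)             ≡⟨ nonMidEdgeColour-outer ⟩
        inject₁ (linkColour x)                ≡⟨ cong inject₁ (sym (linkColour-outer ¬mx)) ⟩
        inject₁ (linkColour (x₃ x))           ≡⟨ sym nonMidEdgeColour-outer ⟩
        nonMidEdgeColour (x₃ x) (x₃ (x₃ x))   ≡⟨ cong₂ nonMidEdgeColour (sym y≡) (outer-involutive ¬mx) ⟩
        nonMidEdgeColour y x                  ∎
      by-cases (no y≢) = begin
        nonMidEdgeColour x y    ≡⟨ nonMidEdgeColour-mate y≢ ⟩
        triangleEdgeColour x y  ≡⟨ sym (triangleEdgeColour-sym t m) ⟩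
        triangleEdgeColour y x  ≡⟨ sym (nonMidEdgeColour-mate x≢) ⟩
        nonMidEdgeColour y x    ∎
        where
        m = ~⇒Mate x~y y≢
        t = Mate⇒OnTriangle ¬mx ¬my m
        x≢ : x ≢ x₃ y
        x≢ x≡ = y≢ (trans (sym (outer-involutive ¬my)) (cong x₃ (sym x≡)))

    colour-sym : ∀ {x y} → x ~ y → colour x y ≡ colour y x
    colour-sym {x} {y} x~y = by-mid (isMid x) (isMid y) refl refl
      where
      by-mid : ∀ a b → isMid x ≡ a → isMid y ≡ b → colour x y ≡ colour y x
      by-mid true  true  mx my = trans (colour-≡ mx my) (sym (colour-≡ my mx))
      by-mid true  false mx my = trans (colour-≡ mx my) (sym (colour-≡ my mx))
      by-mid false true  mx my = trans (colour-≡ mx my) (sym (colour-≡ my mx))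
      by-mid false false mx my = trans (colour-≡ mx my) (trans (nonMidEdgeColour-sym mx my x~y) (sym (colour-≡ my mx)))

    colour-3F : ∀ {u v} → u ~ v → colour u v ≡ 3F →
                (isMid u ≡ true × isMid v ≡ true) ⊎ (OnTriangle u × isFree u ≡ true × Mate u v)
    colour-3F {u} {v} u~v c₃ = by-mid (isMid u) (isMid v) refl refl
      where
      by-mid : ∀ a b → isMid u ≡ a → isMid v ≡ b →
               (isMid u ≡ true × isMid v ≡ true) ⊎ (OnTriangle u × isFree u ≡ true × Mate u v)
      by-mid true  true  mu mv = inj₁ (mu , mv)
      by-mid true  false mu mv = ⊥-elim (3F≢inject₁ (trans (sym c₃) (colour-≡ mu mv)))
      by-mid false true  mu mv = ⊥-elim (3F≢inject₁ (trans (sym c₃) (colour-≡ mu mv)))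
      by-mid false false mu mv with v ≟ x₃ u
      ... | yes v≡ = ⊥-elim (3F≢inject₁ (trans (sym c₃)
                       (trans (colour-≡ mu mv) (trans (cong (nonMidEdgeColour u) v≡) nonMidEdgeColour-outer))))
      ... | no v≢ = by-free (isFree u) refl
        where
        by-free : ∀ b → isFree u ≡ b → (isMid u ≡ true × isMid v ≡ true) ⊎ (OnTriangle u × isFree u ≡ true × Mate u v)
        by-free true  fu = inj₂ (Mate⇒OnTriangle mu mv (~⇒Mate u~v v≢) , fu , ~⇒Mate u~v v≢)
        by-free false fu = ⊥-elim (3F≢inject₁ (trans (sym c₃)
                             (trans (colour-≡ mu mv) (trans (nonMidEdgeColour-mate v≢) (triangleEdgeColour-by fu)))))

    mid-neighbour-isMid : ∀ {m w} → isMid m ≡ true → m ~ w → isMid w ≡ true → w ≡ x₁ m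
    mid-neighbour-isMid {m} {w} mm m~w mw with w ≟ x₁ m
    ... | yes w≡ = w≡
    ... | no w≢  = ⊥-elim (isMid-≢ mw (tip-nonMid mm m~w w≢) refl)

    mid-neighbour-¬OnTriangle : ∀ {m t} → isMid m ≡ true → m ~ t → ¬ OnTriangle t
    mid-neighbour-¬OnTriangle {m} {t} mm m~t (¬mt , ¬m₁) with t ≟ x₁ m
    ... | yes t≡ = isMid-≢ (partner-isMid mm) ¬mt (sym t≡)
    ... | no t≢ with tip-mates mm m~t t≢
    ... | inj₁ (m≡ , _) = isMid-≢ mm ¬m₁ m≡
    ... | inj₂ (_ , x₁m≡) = isMid-≢ (partner-isMid mm) ¬m₁ x₁m≡

    OnTriangle-from-member : ∀ {o y} → isMid o ≡ false → y ∈△ o → OnTriangle y → OnTriangle o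
    OnTriangle-from-member ¬mo first  t = t
    OnTriangle-from-member ¬mo second t = ¬mo , proj₁ t
    OnTriangle-from-member ¬mo third  t = ¬mo , trans (mates-isMid ¬mo) (proj₁ t)

    tip-outer-¬free : ∀ {m t} → isMid m ≡ true → m ~ t → t ≢ x₁ m → isFree (x₃ t) ≡ true → ⊥
    tip-outer-¬free {m} {t} mm m~t t≢ free =
      let (y , y∈ , sy) = isFree-witness free
          cy = selected⇒candidate sy
          to = OnTriangle-from-member (outer-nonMid ¬mt) y∈ (candidate⇒OnTriangle cy)
          t-nonTip = subst (λ u → isTipVertex u ≡ false) (outer-involutive ¬mt)
                       (candidate⇒outer-nonTip cy (∈△-sym to y∈))
      in case trans (sym t-nonTip) t-tip of λ ()
      where
      ¬mt = tip-nonMid mm m~t t≢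
      t-tip : isTipVertex t ≡ true
      t-tip with tip-mates mm m~t t≢
      ... | inj₁ (m≡ , _)   rewrite ¬mt | sym m≡ | mm = refl
      ... | inj₂ (_ , x₁m≡) rewrite ¬mt | sym x₁m≡ | partner-isMid mm = refl

    mids-near : ∀ {u w v} → isMid u ≡ true → u ~⁼ w → w ~⁼ v → isMid v ≡ true → v ≡ u ⊎ v ≡ x₁ u
    mids-near mu (inj₁ refl) (inj₁ refl) mv = inj₁ refl
    mids-near mu (inj₁ refl) (inj₂ u~v)  mv = inj₂ (mid-neighbour-isMid mu u~v mv)
    mids-near {u} {w} mu (inj₂ u~w) w~⁼v mv with w ≟ x₁ u | w~⁼v
    ... | yes w≡ | inj₁ refl = inj₂ w≡
    ... | yes refl | inj₂ w~v = inj₁ (trans (mid-neighbour-isMid (partner-isMid mu) w~v mv) (partner-involutive mu))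
    ... | no w≢ | inj₁ refl = ⊥-elim (isMid-≢ mv (tip-nonMid mu u~w w≢) refl)
    ... | no w≢ | inj₂ w~v with complete w w~v | tip-mates mu u~w w≢
    ... | inj₁ v≡        | inj₁ (u≡ , _)   = inj₁ (trans v≡ (sym u≡))
    ... | inj₁ v≡        | inj₂ (_ , x₁u≡) = inj₂ (trans v≡ (sym x₁u≡))
    ... | inj₂ (inj₁ v≡) | inj₁ (_ , x₁u≡) = inj₂ (trans v≡ (sym x₁u≡))
    ... | inj₂ (inj₁ v≡) | inj₂ (u≡ , _)   = inj₁ (trans v≡ (sym u≡))
    ... | inj₂ (inj₂ v≡) | _ = ⊥-elim (isMid-≢ mv (outer-nonMid (tip-nonMid mu u~w w≢)) v≡)

    mid-far-from-free : ∀ {u w v} → isMid u ≡ true → u ~⁼ w → w ~⁼ v → OnTriangle v → isFree v ≡ true → ⊥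
    mid-far-from-free mu (inj₁ refl) (inj₁ refl) t _ = isMid-≢ mu (proj₁ t) refl
    mid-far-from-free mu (inj₁ refl) (inj₂ u~v)  t _ = mid-neighbour-¬OnTriangle mu u~v t
    mid-far-from-free {u} {w} mu (inj₂ u~w) w~⁼v t free with w ≟ x₁ u | w~⁼v
    ... | yes _    | inj₁ refl = mid-neighbour-¬OnTriangle mu u~w t
    ... | yes refl | inj₂ w~v  = mid-neighbour-¬OnTriangle (partner-isMid mu) w~v t
    ... | no _     | inj₁ refl = mid-neighbour-¬OnTriangle mu u~w t
    ... | no w≢    | inj₂ w~v with complete w w~v | tip-mates mu u~w w≢
    ... | inj₁ refl        | inj₁ (u≡ , _)   = isMid-≢ mu (proj₁ t) u≡
    ... | inj₁ refl        | inj₂ (_ , x₁u≡) = isMid-≢ (partner-isMid mu) (proj₁ t) x₁u≡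
    ... | inj₂ (inj₁ refl) | inj₁ (_ , x₁u≡) = isMid-≢ (partner-isMid mu) (proj₁ t) x₁u≡
    ... | inj₂ (inj₁ refl) | inj₂ (u≡ , _)   = isMid-≢ mu (proj₁ t) u≡
    ... | inj₂ (inj₂ refl) | _               = tip-outer-¬free mu u~w w≢ free

    free-near-via-mate : ∀ {u z v} → OnTriangle u → isFree u ≡ true → z ∈△ u → z ~⁼ v → isFree v ≡ true → v ∈△ u
    free-near-via-mate tu fu z∈ (inj₁ refl) _ = z∈
    free-near-via-mate {z = z} tu fu z∈ (inj₂ z~v) fv with complete z z~v
    ... | inj₁ v≡          = ∈△-trans (∈△-OnTriangle tu z∈) (∈△-sym tu z∈) (inj₂ (inj₁ v≡))
    ... | inj₂ (inj₁ v≡)   = ∈△-trans (∈△-OnTriangle tu z∈) (∈△-sym tu z∈) (inj₂ (inj₂ v≡))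
    ... | inj₂ (inj₂ refl) = ⊥-elim (free-unlinked tu fu z∈ fv)

    free-near-same-triangle : ∀ {u w v} → OnTriangle u → isFree u ≡ true → u ~⁼ w → w ~⁼ v → isFree v ≡ true → v ∈△ u
    free-near-same-triangle tu fu (inj₁ refl) w~⁼v fv = free-near-via-mate tu fu first w~⁼v fv
    free-near-same-triangle {u} {v = v} tu fu (inj₂ u~w) w~⁼v fv with complete u u~w
    ... | inj₁ refl        = free-near-via-mate tu fu second w~⁼v fv
    ... | inj₂ (inj₁ refl) = free-near-via-mate tu fu third w~⁼v fv
    ... | inj₂ (inj₂ refl) = via-outer w~⁼v
      where
      to = outer-of-free-OnTriangle tu fu first
      free-at : ∀ {y} → v ≡ y → isFree y ≡ true
      free-at v≡ = subst (λ y → isFree y ≡ true) v≡ fv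
      via-outer : x₃ u ~⁼ v → v ∈△ u
      via-outer (inj₁ o≡) = ⊥-elim (free-unlinked tu fu first (free-at (sym o≡)))
      via-outer (inj₂ o~v) with complete (x₃ u) o~v
      ... | inj₁ v≡        = ⊥-elim (free-unlinked tu fu first (trans (sym (isFree-∈△ to second)) (free-at v≡)))
      ... | inj₂ (inj₁ v≡) = ⊥-elim (free-unlinked tu fu first (trans (sym (isFree-∈△ to third)) (free-at v≡)))
      ... | inj₂ (inj₂ v≡)   = inj₁ (trans v≡ (outer-involutive (proj₁ tu)))

    open SparseColouring G using (ShareEnd; IsSparseColouring)

    ∈△-shareEnd : ∀ {u u₂ v₁ v₂} → v₁ ∈△ u → v₂ ∈△ u → v₁ ≢ v₂ → Mate u u₂ → ShareEnd u u₂ v₁ v₂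
    ∈△-shareEnd (inj₁ v₁≡) _ _ _ = inj₁ (sym v₁≡)
    ∈△-shareEnd _ (inj₁ v₂≡) _ _ = inj₂ (inj₁ (sym v₂≡))
    ∈△-shareEnd (inj₂ (inj₁ a)) (inj₂ (inj₁ b)) v₁≢v₂ _ = ⊥-elim (v₁≢v₂ (trans a (sym b)))
    ∈△-shareEnd (inj₂ (inj₂ a)) (inj₂ (inj₂ b)) v₁≢v₂ _ = ⊥-elim (v₁≢v₂ (trans a (sym b)))
    ∈△-shareEnd (inj₂ (inj₁ a)) (inj₂ (inj₂ b)) _ (inj₁ c) = inj₂ (inj₂ (inj₁ (trans c (sym a))))
    ∈△-shareEnd (inj₂ (inj₁ a)) (inj₂ (inj₂ b)) _ (inj₂ c) = inj₂ (inj₂ (inj₂ (trans c (sym b))))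
    ∈△-shareEnd (inj₂ (inj₂ a)) (inj₂ (inj₁ b)) _ (inj₁ c) = inj₂ (inj₂ (inj₂ (trans c (sym b))))
    ∈△-shareEnd (inj₂ (inj₂ a)) (inj₂ (inj₁ b)) _ (inj₂ c) = inj₂ (inj₂ (inj₁ (trans c (sym a))))

    colour-sparse : ∀ {u₁ u₂ v₁ v₂ w} → u₁ ~ u₂ → colour u₁ u₂ ≡ 3F → v₁ ~ v₂ → colour v₁ v₂ ≡ 3F →
                    u₁ ~⁼ w → w ~⁼ v₁ → ShareEnd u₁ u₂ v₁ v₂
    colour-sparse u₁~u₂ c₁ v₁~v₂ c₂ s₁ s₂ with colour-3F u₁~u₂ c₁ | colour-3F v₁~v₂ c₂
    ... | inj₁ (m₁ , m₂) | inj₁ (n₁ , _) with mids-near m₁ s₁ s₂ n₁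
    ...   | inj₁ v₁≡ = inj₁ (sym v₁≡)
    ...   | inj₂ v₁≡ = inj₂ (inj₂ (inj₁ (trans (mid-neighbour-isMid m₁ u₁~u₂ m₂) (sym v₁≡))))
    colour-sparse _ _ _ _ s₁ s₂ | inj₁ (m₁ , _) | inj₂ (tv , fv , _) = ⊥-elim (mid-far-from-free m₁ s₁ s₂ tv fv)
    colour-sparse _ _ _ _ s₁ s₂ | inj₂ (tu , fu , _) | inj₁ (n₁ , _) =
      ⊥-elim (mid-far-from-free n₁ (~⁼-sym s₂) (~⁼-sym s₁) tu fu)
    colour-sparse _ _ _ _ s₁ s₂ | inj₂ (tu , fu , mu) | inj₂ (tv , fv , mv) =
      let v₁∈ = free-near-same-triangle tu fu s₁ s₂ fv
          v₂∈ = ∈△-trans (∈△-OnTriangle tu v₁∈) (∈△-sym tu v₁∈) (Mate⇒∈△ mv)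
      in ∈△-shareEnd v₁∈ v₂∈ (Mate⇒≢ mv) mu

    isSparseColouring : IsSparseColouring colour
    isSparseColouring = record
      { symmetric = colour-sym
      ; proper    = ProperAt⇒proper (ProperAt-all _)
      ; sparse    = colour-sparse
      }

  module K₄ (connected : Connected G) (v : V) (triangular : TriangularNeighbourhood v) where

    open Neighbours (neighbours v)
    open SparseColouring G using (IsSparseColouring)

    private
      a~b = proj₁ triangular
      a~c = proj₁ (proj₂ triangular)
      b~c = proj₂ (proj₂ triangular)
      v≢a = ~-irrefl ~a
      v≢b = ~-irrefl ~b
      v≢c = ~-irrefl ~c

    InK₄ : V → Set
    InK₄ x = x ≡ v ⊎ x ∈⟨ a , b , c ⟩

    InK₄-closed : ∀ {y z} → InK₄ y → y ~ z → InK₄ z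
    InK₄-closed (inj₁ refl) y~z = inj₂ (complete y~z)
    InK₄-closed (inj₂ first) y~z with neighbours-complete (~-sym ~a) a~b a~c v≢b v≢c b≢c y~z
    ... | inj₁ z≡        = inj₁ z≡
    ... | inj₂ (inj₁ z≡) = inj₂ (inj₂ (inj₁ z≡))
    ... | inj₂ (inj₂ z≡) = inj₂ (inj₂ (inj₂ z≡))
    InK₄-closed (inj₂ second) y~z with neighbours-complete (~-sym ~b) (~-sym a~b) b~c v≢a v≢c a≢c y~z
    ... | inj₁ z≡        = inj₁ z≡
    ... | inj₂ (inj₁ z≡) = inj₂ (inj₁ z≡)
    ... | inj₂ (inj₂ z≡) = inj₂ (inj₂ (inj₂ z≡))
    InK₄-closed (inj₂ third) y~z with neighbours-complete (~-sym ~c) (~-sym a~c) (~-sym b~c) v≢a v≢b a≢b y~z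
    ... | inj₁ z≡        = inj₁ z≡
    ... | inj₂ (inj₁ z≡) = inj₂ (inj₁ z≡)
    ... | inj₂ (inj₂ z≡) = inj₂ (inj₂ (inj₁ z≡))

    InK₄-all : ∀ x → InK₄ x
    InK₄-all x = reach (inj₁ refl) (connected v x)
      where
      reach : ∀ {y z} → InK₄ y → Star _~_ y z → InK₄ z
      reach y∈ ε          = y∈
      reach y∈ (y~ ◅ path) = reach (InK₄-closed y∈ y~) path

    vertexAt : Fin 4 → V
    vertexAt 0F = v
    vertexAt 1F = a
    vertexAt 2F = b
    vertexAt 3F = c

    position : V → Fin 4
    position x with x ≟ v | x ≟ a | x ≟ b
    ... | yes _ | _     | _     = 0F
    ... | no _  | yes _ | _     = 1F
    ... | no _  | no _  | yes _ = 2F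
    ... | no _  | no _  | no _  = 3F

    vertexAt-position : ∀ x → vertexAt (position x) ≡ x
    vertexAt-position x with x ≟ v | x ≟ a | x ≟ b | InK₄-all x
    ... | yes x≡ | _      | _      | _ = sym x≡
    ... | no _   | yes x≡ | _      | _ = sym x≡
    ... | no _   | no _   | yes x≡ | _ = sym x≡
    ... | no x≢v | no x≢a | no x≢b | x∈ with x∈
    ...   | inj₁ x≡        = ⊥-elim (x≢v x≡)
    ...   | inj₂ (inj₁ x≡) = ⊥-elim (x≢a x≡)
    ...   | inj₂ (inj₂ (inj₁ x≡)) = ⊥-elim (x≢b x≡)
    ...   | inj₂ (inj₂ (inj₂ x≡)) = sym x≡

    position-injective : ∀ {x y} → x ≢ y → position x ≢ position y
    position-injective {x} {y} x≢y same =
      x≢y (trans (sym (vertexAt-position x)) (trans (cong vertexAt same) (vertexAt-position y)))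

    colour : V → V → Fin 4
    colour x y = inject₁ (k4EdgeColour (position x) (position y))

    isSparseColouring : IsSparseColouring colour
    isSparseColouring = record
      { symmetric = λ {x} {y} _ → cong inject₁ (k4EdgeColour-sym (position x) (position y))
      ; proper    = λ {x} {y} {z} x~y x~z y≢z → k4EdgeColour-proper (position x) (position y) (position z)
                      (position-injective (~-irrefl x~y)) (position-injective (~-irrefl x~z)) (position-injective y≢z)
                      ∘ inject₁-injective
      ; sparse    = λ _ c≡3 → ⊥-elim (fromℕ≢inject₁ (sym c≡3))
      }

  sparseColouring : Connected G → Σ (V → V → Fin 4) (SparseColouring.IsSparseColouring G)
  sparseColouring connected with any? triangularNeighbourhood?
  ... | yes (v , triangular) = K₄.colour connected v triangular , K₄.isSparseColouring connected v triangular
  ... | no none = WithoutK₄.colour noK₄ , WithoutK₄.isSparseColouring noK₄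
    where
    noK₄ : ∀ v → ¬ TriangularNeighbourhood v
    noK₄ v triangular = none (v , triangular)

theorem2p4 : (G : Graph) → TwoEdgeConnected G → ClawFree G → Cubic G →
    PackingEdgeColorable G (1 ∷ 1 ∷ 1 ∷ 3 ∷ [])
theorem2p4 G (connected , _) clawFree cubic =
  SparseColouring.packingEdgeColorable G (proj₂ (ClawFreeCubic.sparseColouring G cubic clawFree connected))
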